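{- Let $k$ be a positive integer. Let $G=(V,E,\partial)$ be a finite undirected graph with $V$ the disjoint union of $\{v_1,v_2,v_3,v_4\}$ (four distinct vertices) and a (possibly empty) set $Y$, such that for every edge $e\in E$ at least one of the vertices of $\partial(e)$ lies in $\{v_1,v_2,v_3,v_4\}$. Let $y_1,\ldots,y_m$ be all the vertices of $Y$ having odd degree in $G$ ($m=0$ if there are none). Suppose that after the deletion of any $k-1$ or fewer edges from $G$ there still exists a chain of edges $p$ with $\partial(p)=v_1+v_2+v_3+v_4$. Let $GN$ be any graph obtained from $G$ by adding new edges $\epsilon_1,\ldots,\epsilon_n$ such that each $\partial(\epsilon_i)$ is a sum of two different vertices, one from $\{y_1,\ldots,y_m\}$ and the other from $\{v_1,v_2,v_3,v_4,y_1,\ldots,y_m\}$, and such that each of $y_1,\ldots,y_m$ lies in the boundary of exactly one of the new edges ($n=0$ and $GN=G$ if $m=0$). Then in $GN$ there exist $k$ chains of edges $p_1,\ldots,p_k$, no two of which have a common nontrivial summand, such that $\partial(p_1)=\cdots=\partial(p_k)=v_1+v_2+v_3+v_4$ in $GN$.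
   Context: A graph $G=(V,E,\partial)$ consists of a finite nonempty vertex set $V$, a finite edge set $E$, and a map $\partial$ assigning to each edge a set of exactly two distinct vertices (parallel edges allowed, no loops); we write $\partial(e)=a+b$ for $\partial(e)=\{a,b\}$. The degree of a vertex $v$ is the number of edges $e$ with $v\in\partial(e)$. $A(S)$ is the $\mathbb{F}_2$-vector space of formal $\mathbb{F}_2$-linear combinations of elements of $S$; elements of $A(E)$ are chains of edges, with summands the edges of coefficient $1$. Two chains have no common nontrivial summand if no edge is a summand of both. $\partial$ extends $\mathbb{F}_2$-linearly to $A(E)\to A(V)$. Deleting edges means removing them from $E$ (the vertex set is unchanged). -}

module Defs where

open import Data.Nat using (ℕ; zero; suc; _+_; _<_; _%_)
open import Data.Bool using (Bool; true; false; _∧_; _∨_; _xor_; if_then_else_)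
open import Data.Fin using (Fin; _≟_; splitAt)
open import Data.Fin.Properties using ()
open import Data.Product using (Σ; _×_; _,_; proj₁; proj₂; ∃)
open import Data.Sum using (_⊎_; inj₁; inj₂)
open import Data.Vec.Functional using (foldr)
open import Relation.Nullary using (¬_)
open import Relation.Nullary.Decidable using (⌊_⌋)
open import Relation.Binary.PropositionalEquality using (_≡_; _≢_)
open import Function.Definitions using (Injective)

-- A graph with vertex set Fin N and edge set Fin nE; each edge has two
-- distinct endpoints (an unordered pair, recorded as an ordered pair of
-- distinct vertices).
record Graph (N : ℕ) : Set where
  field
    nE     : ℕ
    ends   : Fin nE → Fin N × Fin N
    noLoop : ∀ e → proj₁ (ends e) ≢ proj₂ (ends e)

open Graph public

incidentB : ∀ {N} → Fin N → Fin N × Fin N → Bool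
incidentB w (a , b) = ⌊ a ≟ w ⌋ ∨ ⌊ b ≟ w ⌋

degree : ∀ {N} → Graph N → Fin N → ℕ
degree G w = foldr (λ e acc → (if incidentB w (ends G e) then 1 else 0) + acc) 0 (λ e → e)

-- Chains of edges = elements of A(E) (F₂-coefficient functions).
Chain : ∀ {N} → Graph N → Set
Chain G = Fin (nE G) → Bool

VChain : ℕ → Set
VChain N = Fin N → Bool

bd : ∀ {N} (G : Graph N) → Chain G → VChain N
bd G p w = foldr (λ e acc → (p e ∧ incidentB w (ends G e)) xor acc) false (λ e → e)

size : ∀ {n} → (Fin n → Bool) → ℕ
size {n} p = foldr (λ e acc → (if p e then 1 else 0) + acc) 0 (λ e → e)

target : ∀ {N} → (Fin 4 → Fin N) → VChain N
target v w = foldr (λ i acc → ⌊ v i ≟ w ⌋ ∨ acc) false (λ i → i)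

IsV : ∀ {N} → (Fin 4 → Fin N) → Fin N → Set
IsV v w = ∃ λ i → v i ≡ w

IsOddY : ∀ {N} → Graph N → (Fin 4 → Fin N) → Fin N → Set
IsOddY G v w = ¬ IsV v w × (degree G w % 2 ≡ 1)

NewEdgeOK : ∀ {N} → Graph N → (Fin 4 → Fin N) → Fin N × Fin N → Set
NewEdgeOK G v (a , b) =
  (a ≢ b) ×
  ((IsOddY G v a × (IsV v b ⊎ IsOddY G v b)) ⊎
   (IsOddY G v b × (IsV v a ⊎ IsOddY G v a)))

-- GN: G with new edges ε₁,…,εₙ appended (edges Fin (nE + n), the old
-- edges first via splitAt).
extend : ∀ {N} (G : Graph N) (n : ℕ) (new : Fin n → Fin N × Fin N) →
         (∀ i → proj₁ (new i) ≢ proj₂ (new i)) → Graph N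
extend G n new ok = record
  { nE = nE G + n
  ; ends = λ e → ends' (splitAt (nE G) e)
  ; noLoop = λ e → ok' (splitAt (nE G) e)
  }
  where
  ends' : Fin (nE G) ⊎ Fin n → _
  ends' (inj₁ e) = ends G e
  ends' (inj₂ i) = new i
  ok' : ∀ x → proj₁ (ends' x) ≢ proj₂ (ends' x)
  ok' (inj₁ e) = noLoop G e
  ok' (inj₂ i) = ok i

module Submission where

-- Every non-terminal vertex of GN has even degree, and all its edges lead to terminals
-- except at most one new edge. Pairing up the edges at each non-terminal y splits GN
-- into trails, each joining two terminals or closed. At y the edges are queued class by
-- class (by their terminal) and the r-th is paired with the (h+r)-th of the 2h: then no
-- trail returns to a terminal unless that terminal holds a strict majority of the edges
-- at y, in which case every trail through y uses it. A new edge between two odd vertices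
-- is continued at both ends by edges chosen compatibly with these majorities.
--
-- Putting y on the side of v_i exactly when i has a majority at y gives a cut isolating
-- v_i in which every trail has at most one edge of G, and only if it ends at v_i. As
-- deleting fewer than k edges of G leaves a T-join, the cut has at least k edges, so
-- every terminal is an end of at least k trails. The k disjoint T-joins are then taken
-- greedily, each made of two trails with complementary pairs of ends or of three trails
-- forming a star; which pairs of ends are missing decides which one is available.

open import Defs
open import Level using (0ℓ)
open import Algebra.Bundles using (CommutativeRing; CommutativeMonoid)
import Algebra.Properties.CommutativeMonoid.Sum as MonoidSum
import Algebra.Properties.Semiring.Sum as SemiringSum
open import Data.Bool using (Bool; true; false; _∧_; _∨_; _xor_; not; if_then_else_)
import Data.Bool as Bool
open import Data.Bool.Properties using (xor-∧-commutativeRing; xor-same; xor-comm; xor-identityʳ; ∨-zeroʳ; ¬-not; ∧-identityʳ; ∧-zeroʳ; ∧-distribʳ-xor; ∧-distribˡ-xor)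
open import Data.Empty using (⊥; ⊥-elim)
open import Data.Fin using (Fin; zero; suc; _≟_; _↑ˡ_; _↑ʳ_; splitAt; punchIn)
open import Data.Fin.Patterns using (0F; 1F; 2F; 3F; 4F; 5F)
open import Data.Fin.Properties using (any?; all?; punchInᵢ≢i; splitAt-↑ˡ; splitAt-↑ʳ; splitAt⁻¹-↑ʳ; ↑ˡ-injective)
open import Data.List using (List; []; _∷_; _++_; length; filter; allFin; tabulate; drop; head)
open import Data.List.Properties using (length-++; length-drop; ++-assoc; ++-identityʳ)
open import Data.List.Membership.Propositional using (_∈_; _∉_)
open import Data.List.Membership.Propositional.Properties using (∈-filter⁺; ∈-filter⁻; ∈-allFin; ∈-++⁺ˡ; ∈-++⁺ʳ; ∈-++⁻)
open import Data.List.Relation.Unary.Any using (here; there)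
open import Data.List.Relation.Unary.All using (All; []; _∷_)
import Data.List.Relation.Unary.All as All
import Data.List.Relation.Unary.All.Properties as All
open import Data.List.Relation.Unary.AllPairs using (AllPairs; []; _∷_)
open import Data.List.Relation.Unary.Unique.Propositional using (Unique)
open import Data.List.Relation.Unary.Unique.Propositional.Properties using (filter⁺; allFin⁺; drop⁺; ++⁺)
open import Data.Maybe using (Maybe; just; nothing; fromMaybe)
open import Data.Maybe.Properties using (just-injective)
open import Data.Nat using (ℕ; zero; suc; _+_; _*_; _∸_; _≤_; _<_; _%_; z≤n; s≤s; s≤s⁻¹; ⌊_/2⌋)
import Data.Nat as ℕ
open import Data.Nat.Properties hiding (_≟_)
open import Data.Product using (Σ; _×_; _,_; proj₁; proj₂; ∃)
open import Data.Product.Properties using (≡-dec)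
open import Data.Sum using (_⊎_; inj₁; inj₂)
open import Data.Vec using (Vec; []; _∷_; lookup)
open import Data.Vec.Functional using (Vector; foldr; removeAt)
open import Function.Definitions using (Injective)
open import Relation.Binary.Definitions using (DecidableEquality)
open import Relation.Binary.PropositionalEquality using (_≡_; _≢_; refl; cong; cong₂; sym; trans; subst; subst₂; module ≡-Reasoning)
open import Relation.Nullary using (¬_; Dec; yes; no; does)
open import Relation.Nullary.Decidable using (⌊_⌋; _⊎-dec_; _×-dec_; _→-dec_; ¬?; toWitness; dec-true; dec-false; isYes≗does)
open import Relation.Unary using (Decidable)

from-⌊⌋ : ∀ {P : Set} (d : Dec P) → ⌊ d ⌋ ≡ true → P
from-⌊⌋ (yes p) _ = p

from-⌊⌋-false : ∀ {P : Set} (d : Dec P) → ⌊ d ⌋ ≡ false → ¬ P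
from-⌊⌋-false (no ¬p) _ = ¬p

to-⌊⌋ : ∀ {P : Set} (d : Dec P) → P → ⌊ d ⌋ ≡ true
to-⌊⌋ (yes _) _ = refl
to-⌊⌋ (no ¬p) p = ⊥-elim (¬p p)

to-⌊⌋-false : ∀ {P : Set} (d : Dec P) → ¬ P → ⌊ d ⌋ ≡ false
to-⌊⌋-false (yes p) ¬p = ⊥-elim (¬p p)
to-⌊⌋-false (no _) _ = refl

infix 4 _==_
_==_ : ∀ {n} → Fin n → Fin n → Bool
a == b = ⌊ a ≟ b ⌋

==-refl : ∀ {n} (a : Fin n) → (a == a) ≡ true
==-refl a = to-⌊⌋ (a ≟ a) refl

==⇒≡ : ∀ {n} {a b : Fin n} → (a == b) ≡ true → a ≡ b
==⇒≡ {a = a} {b} = from-⌊⌋ (a ≟ b)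

≢⇒==false : ∀ {n} {a b : Fin n} → a ≢ b → (a == b) ≡ false
≢⇒==false {a = a} {b} = to-⌊⌋-false (a ≟ b)

==-exclusive : ∀ {n} {a b w : Fin n} → a ≢ b → (a == w) ∧ (b == w) ≡ false
==-exclusive {a = a} {b} {w} a≢b with a ≟ w | b ≟ w
... | yes refl | yes refl = ⊥-elim (a≢b refl)
... | yes _ | no _ = refl
... | no _ | _ = refl

∧-true₁ : ∀ {a b} → a ∧ b ≡ true → a ≡ true
∧-true₁ {true} _ = refl

∧-true₂ : ∀ {a b} → a ∧ b ≡ true → b ≡ true
∧-true₂ {true} ab = ab

∨-as-xor : ∀ x y → x ∧ y ≡ false → x ∨ y ≡ x xor y
∨-as-xor true false _ = refl
∨-as-xor false y _ = refl

-- Boolean identities in four variables are decided by evaluating them.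
∀ᵇ : (Bool → Bool) → Bool
∀ᵇ f = f true ∧ f false

∀ᵇ-sound : ∀ f → ∀ᵇ f ≡ true → ∀ b → f b ≡ true
∀ᵇ-sound f holds true = ∧-true₁ holds
∀ᵇ-sound f holds false = ∧-true₂ {f true} holds

_≡ᵇ_ : Bool → Bool → Bool
a ≡ᵇ b = not (a xor b)

≡ᵇ-sound : ∀ {a b} → (a ≡ᵇ b) ≡ true → a ≡ b
≡ᵇ-sound {true} {true} _ = refl
≡ᵇ-sound {false} {false} _ = refl

identity⁴ : (f g : Bool → Bool → Bool → Bool → Bool) →
  (∀ᵇ λ a → ∀ᵇ λ b → ∀ᵇ λ c → ∀ᵇ λ d → f a b c d ≡ᵇ g a b c d) ≡ true →
  ∀ a b c d → f a b c d ≡ g a b c d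
identity⁴ f g holds a b c d =
  ≡ᵇ-sound (∀ᵇ-sound (P a b c) (∀ᵇ-sound (λ c → ∀ᵇ (P a b c)) (∀ᵇ-sound (λ b → ∀ᵇ λ c → ∀ᵇ (P a b c)) (∀ᵇ-sound (λ a → ∀ᵇ λ b → ∀ᵇ λ c → ∀ᵇ (P a b c)) holds a) b) c) d)
  where
  P : Bool → Bool → Bool → Bool → Bool
  P a b c d = f a b c d ≡ᵇ g a b c d

foldr-map : ∀ {A B C : Set} (f : A → B → B) (z : B) (g : C → A) {n} (xs : Vector C n) →
  foldr (λ c → f (g c)) z xs ≡ foldr f z (λ i → g (xs i))
foldr-map f z g {zero} xs = refl
foldr-map f z g {suc n} xs = cong (f (g (xs zero))) (foldr-map f z g (λ i → xs (suc i)))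

module SumProperties (M : CommutativeMonoid 0ℓ 0ℓ) where
  private module M = CommutativeMonoid M
  open M using (Carrier; _≈_; ε)
  open MonoidSum M public

  sum-δ : ∀ {n} (f : Vector Carrier n) i → (∀ j → j ≢ i → f j ≈ ε) → sum f ≈ f i
  sum-δ {suc n} f i f≈ε = M.trans (sum-remove f) (M.trans (M.∙-congˡ rest≈ε) (M.identityʳ (f i)))
    where
    rest≈ε : sum (removeAt f i) ≈ ε
    rest≈ε = M.trans (sum-cong-≋ (λ j → f≈ε (punchIn i j) (punchInᵢ≢i i j))) (sum-replicate-zero n)

module ℕΣ = SumProperties +-0-commutativeMonoid
module ⊕Σ = SumProperties (CommutativeRing.+-commutativeMonoid xor-∧-commutativeRing)

bit : Bool → ℕ
bit b = if b then 1 else 0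

size-sum : ∀ {n} (P : Fin n → Bool) → size P ≡ ℕΣ.sum (λ e → bit (P e))
size-sum P = foldr-map _+_ 0 (λ e → bit (P e)) (λ e → e)

module _ {n : ℕ} where

  size-cong : {P Q : Fin n → Bool} → (∀ e → P e ≡ Q e) → size P ≡ size Q
  size-cong {P} {Q} P≗Q = trans (size-sum P) (trans (ℕΣ.sum-cong-≗ (λ e → cong bit (P≗Q e))) (sym (size-sum Q)))

  size-none : (P : Fin n → Bool) → (∀ e → P e ≡ false) → size P ≡ 0
  size-none P none = trans (size-sum P) (trans (ℕΣ.sum-cong-≗ (λ e → cong bit (none e))) (ℕΣ.sum-replicate-zero n))

  size-single : (c : Fin n) → size (_== c) ≡ 1
  size-single c = trans (size-sum (_== c)) (trans (ℕΣ.sum-δ _ c (λ e e≢c → cong bit (≢⇒==false e≢c))) (cong bit (==-refl c)))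

  size-witness : (P : Fin n → Bool) → 0 < size P → ∃ λ e → P e ≡ true
  size-witness P pos with any? (λ e → P e Bool.≟ true)
  ... | yes witness = witness
  ... | no none with () ← subst (0 <_) (size-none P (λ e → ¬-not (λ pe → none (e , pe)))) pos

  size-≤1 : (P : Fin n → Bool) → (∀ e e′ → P e ≡ true → P e′ ≡ true → e ≡ e′) → size P ≤ 1
  size-≤1 P unique with any? (λ e → P e Bool.≟ true)
  ... | no none = ≤-trans (≤-reflexive (size-none P (λ e → ¬-not (λ pe → none (e , pe))))) z≤n
  ... | yes (c , pc) = ≤-reflexive (trans (size-cong P≗c) (size-single c))
    where
    P≗c : ∀ e → P e ≡ (e == c)
    P≗c e with e ≟ c
    ... | yes refl = pc
    ... | no e≢c = ¬-not (λ pe → e≢c (unique e c pe pc))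

  size-∨ : (P Q : Fin n → Bool) → (∀ e → P e ∧ Q e ≡ false) → size (λ e → P e ∨ Q e) ≡ size P + size Q
  size-∨ P Q disjoint = begin
    size (λ e → P e ∨ Q e)                ≡⟨ size-sum (λ e → P e ∨ Q e) ⟩
    ℕΣ.sum (λ e → bit (P e ∨ Q e))        ≡⟨ ℕΣ.sum-cong-≗ (λ e → bit-∨ (P e) (Q e) (disjoint e)) ⟩
    ℕΣ.sum (λ e → bit (P e) + bit (Q e))  ≡⟨ ℕΣ.∑-distrib-+ (λ e → bit (P e)) (λ e → bit (Q e)) ⟩
    ℕΣ.sum (λ e → bit (P e)) + ℕΣ.sum (λ e → bit (Q e)) ≡⟨ cong₂ _+_ (size-sum P) (size-sum Q) ⟨
    size P + size Q                       ∎
    where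
    open ≡-Reasoning
    bit-∨ : ∀ a b → a ∧ b ≡ false → bit (a ∨ b) ≡ bit a + bit b
    bit-∨ true false _ = refl
    bit-∨ false b _ = refl

  size-remove : (P : Fin n → Bool) (c : Fin n) → P c ≡ true → size P ≡ suc (size (λ e → P e ∧ not (e == c)))
  size-remove P c pc = begin
    size P                                         ≡⟨ size-cong P≗ ⟩
    size (λ e → (e == c) ∨ (P e ∧ not (e == c)))   ≡⟨ size-∨ (_== c) (λ e → P e ∧ not (e == c)) disjoint ⟩
    size (_== c) + size (λ e → P e ∧ not (e == c)) ≡⟨ cong (_+ size (λ e → P e ∧ not (e == c))) (size-single c) ⟩
    suc (size (λ e → P e ∧ not (e == c)))          ∎
    where
    open ≡-Reasoning
    P≗ : ∀ e → P e ≡ ((e == c) ∨ (P e ∧ not (e == c)))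
    P≗ e with e ≟ c
    ... | yes refl = pc
    ... | no _ = sym (∧-identityʳ (P e))
    disjoint : ∀ e → (e == c) ∧ (P e ∧ not (e == c)) ≡ false
    disjoint e with e ≟ c
    ... | yes _ = ∧-zeroʳ (P e)
    ... | no _ = refl

sum-mono : ∀ {n} {f g : Fin n → ℕ} → (∀ i → f i ≤ g i) → ℕΣ.sum f ≤ ℕΣ.sum g
sum-mono {zero} f≤g = z≤n
sum-mono {suc n} f≤g = +-mono-≤ (f≤g zero) (sum-mono (λ i → f≤g (suc i)))

sum-split : ∀ m {n} (f : Fin (m + n) → ℕ) → ℕΣ.sum f ≡ ℕΣ.sum (λ i → f (i ↑ˡ n)) + ℕΣ.sum (λ j → f (m ↑ʳ j))
sum-split zero f = refl
sum-split (suc m) {n} f = trans (cong (f zero +_) (sum-split m (λ i → f (suc i)))) (sym (+-assoc (f zero) (ℕΣ.sum (λ i → f (suc (i ↑ˡ n)))) (ℕΣ.sum (λ j → f (suc m ↑ʳ j)))))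

-- Double counting: the fibres of g over A have at most one element each.
size-injection : ∀ {m n} (A : Fin m → Bool) (B : Fin n → Bool) (g : Fin m → Fin n) →
  (∀ e → A e ≡ true → B (g e) ≡ true) →
  (∀ e e′ → A e ≡ true → A e′ ≡ true → g e ≡ g e′ → e ≡ e′) → size A ≤ size B
size-injection {m} {n} A B g A⇒B injective = begin
  size A                                           ≡⟨ size-sum A ⟩
  ℕΣ.sum (λ e → bit (A e))                         ≡⟨ ℕΣ.sum-cong-≗ (λ e → sym (fibres e)) ⟩
  ℕΣ.sum (λ e → ℕΣ.sum (λ c → bit (fibre c e)))    ≡⟨ ℕΣ.∑-comm (λ e c → bit (fibre c e)) ⟩
  ℕΣ.sum (λ c → ℕΣ.sum (λ e → bit (fibre c e)))    ≤⟨ sum-mono fibre≤B ⟩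
  ℕΣ.sum (λ c → bit (B c))                         ≡⟨ size-sum B ⟨
  size B                                           ∎
  where
  open ≤-Reasoning
  fibre : Fin n → Fin m → Bool
  fibre c e = A e ∧ (g e == c)
  fibres : ∀ e → ℕΣ.sum (λ c → bit (fibre c e)) ≡ bit (A e)
  fibres e = trans (ℕΣ.sum-δ _ (g e) (λ c c≢ge → trans (cong (λ b → bit (A e ∧ b)) (≢⇒==false (λ ge≡c → c≢ge (sym ge≡c)))) (cong bit (∧-zeroʳ (A e)))))
                   (trans (cong (λ b → bit (A e ∧ b)) (==-refl (g e))) (cong bit (∧-identityʳ (A e))))
  fibre≤B : ∀ c → ℕΣ.sum (λ e → bit (fibre c e)) ≤ bit (B c)
  fibre≤B c with B c in Bc
  ... | true = subst (_≤ 1) (size-sum (fibre c)) (size-≤1 (fibre c) (λ e e′ p p′ → injective e e′ (∧-true₁ p) (∧-true₁ p′) (trans (==⇒≡ (∧-true₂ p)) (sym (==⇒≡ (∧-true₂ p′))))))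
  ... | false = ≤-reflexive (trans (sym (size-sum (fibre c))) (size-none (fibre c) outside))
    where
    outside : ∀ e → fibre c e ≡ false
    outside e with A e in Ae | g e ≟ c
    ... | false | _ = refl
    ... | true | no _ = refl
    ... | true | yes refl with () ← trans (sym (A⇒B e Ae)) Bc

size-filter : ∀ {m} {P : Fin m → Set} (P? : Decidable P) →
  length (filter P? (allFin m)) ≡ size (λ e → does (P? e))
size-filter {m} P? = trans (length-filter-tabulate P? (λ e → e)) (sym (size-sum (λ e → does (P? e))))
  where
  length-filter-tabulate : ∀ {k} {B : Set} {Q : B → Set} (Q? : Decidable Q) (f : Fin k → B) →
    length (filter Q? (tabulate f)) ≡ ℕΣ.sum (λ i → bit (does (Q? (f i))))
  length-filter-tabulate {zero} Q? f = refl
  length-filter-tabulate {suc k} Q? f with does (Q? (f zero))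
  ... | true = cong suc (length-filter-tabulate Q? (λ i → f (suc i)))
  ... | false = length-filter-tabulate Q? (λ i → f (suc i))

sum-minus-one : ∀ {n} (m : Fin n → ℕ) r → 0 < m r → suc (ℕΣ.sum (λ t → m t ∸ bit (r == t))) ≡ ℕΣ.sum m
sum-minus-one m r pos = sym (begin
  ℕΣ.sum m                                                  ≡⟨ ℕΣ.sum-cong-≗ (λ t → sym (m∸n+n≡m (b≤m t))) ⟩
  ℕΣ.sum (λ t → m t ∸ b t + b t)                            ≡⟨ ℕΣ.∑-distrib-+ (λ t → m t ∸ b t) b ⟩
  ℕΣ.sum (λ t → m t ∸ b t) + ℕΣ.sum b                       ≡⟨ cong (ℕΣ.sum (λ t → m t ∸ b t) +_) one ⟩
  ℕΣ.sum (λ t → m t ∸ b t) + 1                              ≡⟨ +-comm _ 1 ⟩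
  suc (ℕΣ.sum (λ t → m t ∸ b t))                            ∎)
  where
  open ≡-Reasoning
  b : _ → ℕ
  b t = bit (r == t)
  b≤m : ∀ t → b t ≤ m t
  b≤m t with r ≟ t
  ... | yes refl = pos
  ... | no _ = z≤n
  one : ℕΣ.sum b ≡ 1
  one = trans (ℕΣ.sum-δ b r (λ t t≢r → cong bit (≢⇒==false (λ r≡t → t≢r (sym r≡t))))) (cong bit (==-refl r))

size-∨-≤ : ∀ {n} (P Q : Fin n → Bool) → size (λ e → P e ∨ Q e) ≤ size P + size Q
size-∨-≤ P Q = begin
  size (λ e → P e ∨ Q e)                         ≡⟨ size-sum (λ e → P e ∨ Q e) ⟩
  ℕΣ.sum (λ e → bit (P e ∨ Q e))                 ≤⟨ sum-mono (λ e → bit-∨ (P e) (Q e)) ⟩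
  ℕΣ.sum (λ e → bit (P e) + bit (Q e))           ≡⟨ ℕΣ.∑-distrib-+ (λ e → bit (P e)) (λ e → bit (Q e)) ⟩
  ℕΣ.sum (λ e → bit (P e)) + ℕΣ.sum (λ e → bit (Q e)) ≡⟨ cong₂ _+_ (size-sum P) (size-sum Q) ⟨
  size P + size Q                                ∎
  where
  open ≤-Reasoning
  bit-∨ : ∀ a b → bit (a ∨ b) ≤ bit a + bit b
  bit-∨ true b = s≤s z≤n
  bit-∨ false b = ≤-refl

Odd : ℕ → Set
Odd n = n % 2 ≡ 1

odd-positive : ∀ {n} → Odd n → 0 < n
odd-positive {suc n} _ = s≤s z≤n

data Parity (m : ℕ) : Set where
  twice   : ∀ h → m ≡ h + h → Parity m
  twice+1 : ∀ h → m ≡ suc (h + h) → Parity m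

parity : ∀ m → Parity m
parity zero = twice 0 refl
parity (suc m) with parity m
... | twice h m≡ = twice+1 h (cong suc m≡)
... | twice+1 h m≡ = twice (suc h) (cong suc (trans m≡ (sym (+-suc h h))))

odd-% : ∀ h → suc (h + h) % 2 ≡ 1
odd-% zero = refl
odd-% (suc h) rewrite +-suc h h = odd-% h

even-% : ∀ h → (h + h) % 2 ≡ 0
even-% zero = refl
even-% (suc h) rewrite +-suc h h = even-% h

half-double : ∀ h → ⌊ h + h /2⌋ ≡ h
half-double zero = refl
half-double (suc h) rewrite +-suc h h = cong suc (half-double h)

private
  double : ∀ x → x + x ≡ 2 * x
  double x = cong (x +_) (sym (+-identityʳ x))

halve-< : ∀ {x y} → x + x < 2 * y → x < y
halve-< {x} {y} lt = *-cancelˡ-< 2 x y (subst (_< 2 * y) (double x) lt)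

halve-≤ : ∀ {x y} → 2 * y ≤ x + x → y ≤ x
halve-≤ {x} {y} le = *-cancelˡ-≤ 2 (subst (2 * y ≤_) (double x) le)

halve-<′ : ∀ {x y} → suc (x + x) < 2 * y → x < y
halve-<′ lt = halve-< (<-trans (n<1+n _) lt)

halve-≤′ : ∀ {x y} → 2 * y ≤ suc (x + x) → y ≤ x
halve-≤′ {x} {y} le with x <? y
... | no x≮y = ≮⇒≥ x≮y
... | yes x<y = ⊥-elim (<-irrefl refl (begin-strict
  suc (x + x)       <⟨ n<1+n _ ⟩
  suc (suc (x + x)) ≡⟨ cong suc (+-suc x x) ⟨
  suc x + suc x     ≡⟨ double (suc x) ⟩
  2 * suc x         ≤⟨ *-monoʳ-≤ 2 x<y ⟩
  2 * y             ≤⟨ le ⟩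
  suc (x + x)       ∎))
  where open ≤-Reasoning

odd-half : ∀ {m} → Odd m → ∃ λ h → m ≡ suc (h + h)
odd-half {m} odd-m with parity m
... | twice+1 h m≡ = h , m≡
... | twice h m≡ with () ← trans (sym odd-m) (trans (cong (_% 2) m≡) (even-% h))

-- Chains and cuts

private module ⊕Ring = SemiringSum (CommutativeRing.semiring xor-∧-commutativeRing)

module _ {N} (G : Graph N) where

  bd-sum : ∀ p w → bd G p w ≡ ⊕Σ.sum (λ e → p e ∧ incidentB w (ends G e))
  bd-sum p w = foldr-map _xor_ false (λ e → p e ∧ incidentB w (ends G e)) (λ e → e)

  cut : (Fin N → Bool) → Chain G
  cut S e = S (proj₁ (ends G e)) xor S (proj₂ (ends G e))

  endpoint-sum : (S : Fin N → Bool) (a b : Fin N) → a ≢ b → ⊕Σ.sum (λ w → S w ∧ incidentB w (a , b)) ≡ S a xor S b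
  endpoint-sum S a b a≢b = begin
    ⊕Σ.sum (λ w → S w ∧ incidentB w (a , b))                  ≡⟨ ⊕Σ.sum-cong-≗ split ⟩
    ⊕Σ.sum (λ w → (S w ∧ (a == w)) xor (S w ∧ (b == w)))      ≡⟨ ⊕Σ.∑-distrib-+ (λ w → S w ∧ (a == w)) (λ w → S w ∧ (b == w)) ⟩
    ⊕Σ.sum (λ w → S w ∧ (a == w)) xor ⊕Σ.sum (λ w → S w ∧ (b == w)) ≡⟨ cong₂ _xor_ (point a) (point b) ⟩
    S a xor S b                                               ∎
    where
    open ≡-Reasoning
    split : ∀ w → S w ∧ incidentB w (a , b) ≡ (S w ∧ (a == w)) xor (S w ∧ (b == w))
    split w = trans (cong (S w ∧_) (∨-as-xor (a == w) (b == w) (==-exclusive a≢b))) (∧-distribˡ-xor (S w) (a == w) (b == w))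
    point : ∀ c → ⊕Σ.sum (λ w → S w ∧ (c == w)) ≡ S c
    point c = trans (⊕Σ.sum-δ _ c (λ w w≢c → trans (cong (S w ∧_) (≢⇒==false (λ c≡w → w≢c (sym c≡w)))) (∧-zeroʳ (S w))))
                    (trans (cong (S c ∧_) (==-refl c)) (∧-identityʳ (S c)))

  cut-parity : ∀ S p → ⊕Σ.sum (λ w → S w ∧ bd G p w) ≡ ⊕Σ.sum (λ e → p e ∧ cut S e)
  cut-parity S p = begin
    ⊕Σ.sum (λ w → S w ∧ bd G p w)                            ≡⟨ ⊕Σ.sum-cong-≗ (λ w → trans (cong (S w ∧_) (bd-sum p w)) (⊕Ring.*-distribˡ-sum (S w) (λ e → p e ∧ incident w e))) ⟩
    ⊕Σ.sum (λ w → ⊕Σ.sum (λ e → S w ∧ (p e ∧ incident w e))) ≡⟨ ⊕Σ.∑-comm (λ w e → S w ∧ (p e ∧ incident w e)) ⟩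
    ⊕Σ.sum (λ e → ⊕Σ.sum (λ w → S w ∧ (p e ∧ incident w e))) ≡⟨ ⊕Σ.sum-cong-≗ (λ e → trans (⊕Σ.sum-cong-≗ (λ w → ∧-swap (S w) (p e) _)) (sym (⊕Ring.*-distribˡ-sum (p e) (λ w → S w ∧ incident w e)))) ⟩
    ⊕Σ.sum (λ e → p e ∧ ⊕Σ.sum (λ w → S w ∧ incident w e))   ≡⟨ ⊕Σ.sum-cong-≗ (λ e → cong (p e ∧_) (endpoint-sum S _ _ (noLoop G e))) ⟩
    ⊕Σ.sum (λ e → p e ∧ cut S e)                             ∎
    where
    open ≡-Reasoning
    incident : Fin N → Fin (nE G) → Bool
    incident w e = incidentB w (ends G e)
    ∧-swap : ∀ a b c → a ∧ (b ∧ c) ≡ b ∧ (a ∧ c)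
    ∧-swap true b c = refl
    ∧-swap false b c = sym (∧-zeroʳ b)

  cut-avoiding-parity : ∀ S p → (∀ e → cut S e ≡ true → p e ≡ false) → ⊕Σ.sum (λ w → S w ∧ bd G p w) ≡ false
  cut-avoiding-parity S p avoids = trans (cut-parity S p) (trans (⊕Σ.sum-cong-≗ disjoint) (⊕Σ.sum-replicate-zero (nE G)))
    where
    disjoint : ∀ e → p e ∧ cut S e ≡ false
    disjoint e with cut S e in cutₑ
    ... | true = cong (_∧ true) (avoids e cutₑ)
    ... | false = ∧-zeroʳ (p e)

  -- Deleting a cut of odd τ-weight destroys every chain with boundary τ.
  odd-cut-size : (k : ℕ) (τ : VChain N) →
    (∀ (D : Chain G) → size D < k → Σ (Chain G) λ p → (∀ e → D e ≡ true → p e ≡ false) × (∀ w → bd G p w ≡ τ w)) →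
    (S : Fin N → Bool) → ⊕Σ.sum (λ w → S w ∧ τ w) ≡ true → k ≤ size (cut S)
  odd-cut-size k τ robust S odd with size (cut S) <? k
  ... | no ¬small = ≮⇒≥ ¬small
  ... | yes small with robust (cut S) small
  ... | p , avoids , bd≡τ with () ← trans (sym odd) (trans (⊕Σ.sum-cong-≗ (λ w → cong (S w ∧_) (sym (bd≡τ w)))) (cut-avoiding-parity S p avoids))

  bd-cong : ∀ {p q} → (∀ e → p e ≡ q e) → ∀ w → bd G p w ≡ bd G q w
  bd-cong {p} {q} p≗q w = trans (bd-sum p w) (trans (⊕Σ.sum-cong-≗ (λ e → cong (_∧ incidentB w (ends G e)) (p≗q e))) (sym (bd-sum q w)))

  bd-xor : ∀ p q w → bd G (λ e → p e xor q e) w ≡ bd G p w xor bd G q w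
  bd-xor p q w = begin
    bd G (λ e → p e xor q e) w                                         ≡⟨ bd-sum _ w ⟩
    ⊕Σ.sum (λ e → (p e xor q e) ∧ incident e)                          ≡⟨ ⊕Σ.sum-cong-≗ (λ e → ∧-distribʳ-xor (incident e) (p e) (q e)) ⟩
    ⊕Σ.sum (λ e → (p e ∧ incident e) xor (q e ∧ incident e))          ≡⟨ ⊕Σ.∑-distrib-+ (λ e → p e ∧ incident e) (λ e → q e ∧ incident e) ⟩
    ⊕Σ.sum (λ e → p e ∧ incident e) xor ⊕Σ.sum (λ e → q e ∧ incident e) ≡⟨ cong₂ _xor_ (bd-sum p w) (bd-sum q w) ⟨
    bd G p w xor bd G q w                                              ∎
    where
    open ≡-Reasoning
    incident : Fin (nE G) → Bool
    incident e = incidentB w (ends G e)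

  bd-empty : ∀ w → bd G (λ _ → false) w ≡ false
  bd-empty w = trans (bd-sum (λ _ → false) w) (⊕Σ.sum-replicate-zero (nE G))

  open import Data.List.Membership.DecPropositional (_≟_ {nE G}) using (_∈?_)

  incidenceSum : Fin N → List (Fin (nE G)) → Bool
  incidenceSum w [] = false
  incidenceSum w (e ∷ es) = incidentB w (ends G e) xor incidenceSum w es

  chainOf : List (Fin (nE G)) → Chain G
  chainOf xs e = ⌊ e ∈? xs ⌋

  bd-single : ∀ x w → bd G (_== x) w ≡ incidentB w (ends G x)
  bd-single x w = trans (bd-sum (_== x) w) (trans (⊕Σ.sum-δ _ x (λ e e≢x → cong (_∧ incidentB w (ends G e)) (≢⇒==false e≢x)))
                                                 (cong (_∧ incidentB w (ends G x)) (==-refl x)))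

  bd-chainOf : ∀ {xs} → Unique xs → ∀ w → bd G (chainOf xs) w ≡ incidenceSum w xs
  bd-chainOf {[]} [] w = bd-empty w
  bd-chainOf {x ∷ xs} (x∉ ∷ unique) w = begin
    bd G (chainOf (x ∷ xs)) w                        ≡⟨ bd-cong cons w ⟩
    bd G (λ e → (e == x) xor chainOf xs e) w         ≡⟨ bd-xor (_== x) (chainOf xs) w ⟩
    bd G (_== x) w xor bd G (chainOf xs) w           ≡⟨ cong₂ _xor_ (bd-single x w) (bd-chainOf unique w) ⟩
    incidenceSum w (x ∷ xs)                          ∎
    where
    open ≡-Reasoning
    cons : ∀ e → chainOf (x ∷ xs) e ≡ (e == x) xor chainOf xs e
    cons e with e ≟ x | e ∈? xs
    ... | yes refl | yes e∈ = ⊥-elim (All.lookup x∉ e∈ refl)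
    ... | yes _ | no _ = refl
    ... | no _ | yes _ = refl
    ... | no _ | no _ = refl

module _ {A : Set} where

  nth : List A → ℕ → Maybe A
  nth [] p = nothing
  nth (x ∷ xs) zero = just x
  nth (x ∷ xs) (suc p) = nth xs p

  position : ∀ {x} {xs : List A} → x ∈ xs → ℕ
  position (here _) = zero
  position (there m) = suc (position m)

  nth-position : ∀ {x} {xs : List A} (m : x ∈ xs) → nth xs (position m) ≡ just x
  nth-position (here refl) = refl
  nth-position (there m) = nth-position m

  nth-∈ : ∀ (xs : List A) p {x} → nth xs p ≡ just x → x ∈ xs
  nth-∈ (y ∷ xs) zero refl = here refl
  nth-∈ (y ∷ xs) (suc p) eq = there (nth-∈ xs p eq)

  nth-< : ∀ (xs : List A) p {x} → nth xs p ≡ just x → p < length xs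
  nth-< (y ∷ xs) zero _ = s≤s z≤n
  nth-< (y ∷ xs) (suc p) eq = s≤s (nth-< xs p eq)

  nth-defined : ∀ (xs : List A) p → p < length xs → ∃ λ x → nth xs p ≡ just x
  nth-defined (y ∷ xs) zero _ = y , refl
  nth-defined (y ∷ xs) (suc p) (s≤s p<) = nth-defined xs p p<

  position-unique : ∀ {xs : List A} → Unique xs → ∀ p {x} → nth xs p ≡ just x → (m : x ∈ xs) → position m ≡ p
  position-unique (x∉ ∷ _) zero refl (here refl) = refl
  position-unique (x∉ ∷ _) zero refl (there m) = ⊥-elim (All.lookup x∉ m refl)
  position-unique {y ∷ xs} (y∉ ∷ _) (suc p) eq (here refl) = ⊥-elim (All.lookup y∉ (nth-∈ xs p eq) refl)
  position-unique (_ ∷ u) (suc p) eq (there m) = cong suc (position-unique u p eq m)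

  ∈-drop⁻ : ∀ k (xs : List A) {x} → x ∈ drop k xs → x ∈ xs
  ∈-drop⁻ zero xs x∈ = x∈
  ∈-drop⁻ (suc k) (y ∷ xs) x∈ = there (∈-drop⁻ k xs x∈)

  ∈-not-in-tail : ∀ (xs : List A) {x} → x ∈ xs → ¬ (x ∈ drop 1 xs) → head xs ≡ just x
  ∈-not-in-tail (y ∷ xs) (here refl) _ = refl
  ∈-not-in-tail (y ∷ xs) (there x∈) x∉ = ⊥-elim (x∉ x∈)

  head-∈ : ∀ (xs : List A) {x} → head xs ≡ just x → x ∈ xs
  head-∈ (y ∷ xs) refl = here refl

  head-∉-tail : ∀ {xs : List A} {x} → Unique xs → head xs ≡ just x → ¬ (x ∈ drop 1 xs)
  head-∉-tail {y ∷ xs} (y∉ ∷ _) refl y∈ = All.lookup y∉ y∈ refl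

  nth-++⁻ : ∀ (xs ys : List A) p {x} → nth (xs ++ ys) p ≡ just x →
    (p < length xs × x ∈ xs) ⊎ (∃ λ r → p ≡ length xs + r × nth ys r ≡ just x)
  nth-++⁻ [] ys p eq = inj₂ (p , refl , eq)
  nth-++⁻ (y ∷ xs) ys zero refl = inj₁ (s≤s z≤n , here refl)
  nth-++⁻ (y ∷ xs) ys (suc p) eq with nth-++⁻ xs ys p eq
  ... | inj₁ (p< , m) = inj₁ (s≤s p< , there m)
  ... | inj₂ (r , refl , eq′) = inj₂ (r , refl , eq′)

  module Block (T : A → Bool) (pre mid post : List A)
    (pre-F : All (λ x → T x ≡ false) pre) (mid-T : All (λ x → T x ≡ true) mid) (post-F : All (λ x → T x ≡ false) post) where

    -- the elements satisfying T occupy the positions [a, a + m)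
    a m : ℕ
    a = length pre
    m = length mid

    block⁻ : ∀ p {x} → nth (pre ++ mid ++ post) p ≡ just x → T x ≡ true → a ≤ p × p < a + m
    block⁻ p eq Tx with nth-++⁻ pre (mid ++ post) p eq
    ... | inj₁ (_ , x∈pre) with () ← trans (sym Tx) (All.lookup pre-F x∈pre)
    ... | inj₂ (r , refl , eq′) with nth-++⁻ mid post r eq′
    ...   | inj₁ (r< , _) = m≤m+n a r , +-monoʳ-< a r<
    ...   | inj₂ (s , refl , eq″) with () ← trans (sym Tx) (All.lookup post-F (nth-∈ post s eq″))

    block⁺ : ∀ p {x} → nth (pre ++ mid ++ post) p ≡ just x → a ≤ p → p < a + m → T x ≡ true
    block⁺ p eq a≤p p<a+m with nth-++⁻ pre (mid ++ post) p eq
    ... | inj₁ (p<a , _) = ⊥-elim (<-irrefl refl (<-≤-trans p<a a≤p))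
    ... | inj₂ (r , refl , eq′) with nth-++⁻ mid post r eq′
    ...   | inj₁ (_ , x∈mid) = All.lookup mid-T x∈mid
    ...   | inj₂ (s , refl , _) = ⊥-elim (<-irrefl refl (<-≤-trans (+-cancelˡ-< a _ _ p<a+m) (m≤m+n m s)))

-- a pair sits at positions r < h and h + r; a block occupies the positions [a, a + m)
private
  pair-apart : ∀ {a m h r} → m ≤ h → a ≤ r → h + r < a + m → ⊥
  pair-apart {a} {m} {h} {r} m≤h a≤r lt = <-irrefl refl (<-≤-trans lt (begin
    a + m ≤⟨ +-monoʳ-≤ a m≤h ⟩
    a + h ≡⟨ +-comm a h ⟩
    h + a ≤⟨ +-monoʳ-≤ h a≤r ⟩
    h + r ∎))
    where open ≤-Reasoning

  pair-covered : ∀ {a m h r} → h ≤ m → a + m ≤ h + h → r < h → r < a ⊎ a + m ≤ r → h + r < a ⊎ a + m ≤ h + r → ⊥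
  pair-covered {a} {m} h≤m _ r<h (inj₂ a+m≤r) _ = <-irrefl refl (<-≤-trans r<h (≤-trans h≤m (≤-trans (m≤n+m m a) a+m≤r)))
  pair-covered {a} {m} {h} {r} h≤m bound r<h (inj₁ r<a) (inj₁ h+r<a) =
    <-irrefl refl (<-≤-trans (+-monoˡ-< h (≤-<-trans (m≤m+n h r) h+r<a)) (≤-trans (+-monoʳ-≤ a h≤m) bound))
  pair-covered {a} {m} {h} {r} h≤m _ r<h (inj₁ r<a) (inj₂ a+m≤h+r) =
    <-irrefl refl (<-≤-trans r<a (+-cancelˡ-≤ h a r (subst (_≤ h + r) (+-comm a h) (≤-trans (+-monoʳ-≤ a h≤m) a+m≤h+r))))

-- Pair the element at position r of a list of length 2h with the one at position h + r.
-- If the elements satisfying T form a block of length at most h no pair lies inside it,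
-- and if the block has length at least h every pair meets it.
module HalfPairing {A : Set} (_≟_ : DecidableEquality A) (L : List A) (h : ℕ) where

  open import Data.List.Membership.DecPropositional _≟_ using (_∈?_)

  matePosition : ℕ → ℕ
  matePosition p with p <? h
  ... | yes _ = h + p
  ... | no _ = p ∸ h

  mate : A → A
  mate x with x ∈? L
  ... | yes x∈L = fromMaybe x (nth L (matePosition (position x∈L)))
  ... | no _ = x

  firstHalf : A → Bool
  firstHalf x with x ∈? L
  ... | yes x∈L = ⌊ position x∈L <? h ⌋
  ... | no _ = false

  module Properties (L-unique : Unique L) (L-length : length L ≡ h + h) where

    private
      matePositions : ∀ p → p < h + h →
        (p < h × matePosition p ≡ h + p) ⊎ (matePosition p < h × p ≡ h + matePosition p)
      matePositions p p<2h with p <? h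
      ... | yes p<h = inj₁ (p<h , refl)
      ... | no p≮h = inj₂ (+-cancelˡ-< h _ _ (subst (_< h + h) p≡ p<2h) , p≡)
        where
        p≡ : p ≡ h + (p ∸ h)
        p≡ = sym (m+[n∸m]≡n (≮⇒≥ p≮h))

      matePosition-< : ∀ p → p < h + h → matePosition p < h + h
      matePosition-< p p<2h with matePositions p p<2h
      ... | inj₁ (p<h , q≡) = subst (_< h + h) (sym q≡) (+-monoʳ-< h p<h)
      ... | inj₂ (q<h , _) = ≤-trans q<h (m≤m+n h h)

      matePosition-involutive : ∀ p → p < h + h → matePosition (matePosition p) ≡ p
      matePosition-involutive p p<2h with p <? h
      ... | yes p<h with (h + p) <? h
      ...   | yes h+p<h = ⊥-elim (<-irrefl refl (≤-<-trans (m≤m+n h p) h+p<h))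
      ...   | no _ = m+n∸m≡n h p
      matePosition-involutive p p<2h | no p≮h with (p ∸ h) <? h
      ...   | yes _ = m+[n∸m]≡n (≮⇒≥ p≮h)
      ...   | no p∸h≮h = ⊥-elim (p∸h≮h (+-cancelˡ-< h _ _ (subst (_< h + h) (sym (m+[n∸m]≡n (≮⇒≥ p≮h))) p<2h)))

      matePosition-≢ : ∀ p → p < h + h → matePosition p ≢ p
      matePosition-≢ p p<2h q≡p with matePositions p p<2h
      ... | inj₁ (p<h , q≡) = <-irrefl refl (<-≤-trans p<h (subst (h ≤_) (trans (sym q≡) q≡p) (m≤m+n h p)))
      ... | inj₂ (q<h , p≡) = <-irrefl refl (<-≤-trans q<h (subst (h ≤_) (trans (sym p≡) (sym q≡p)) (m≤m+n h _)))

      at-mate : ∀ p {x} → nth L p ≡ just x → nth L (matePosition p) ≡ just (mate x)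
      at-mate p {x} eq with x ∈? L
      ... | no x∉L = ⊥-elim (x∉L (nth-∈ L p eq))
      ... | yes x∈L rewrite position-unique L-unique p eq x∈L with nth-defined L (matePosition p) (subst (matePosition p <_) (sym L-length) (matePosition-< p p<2h))
        where p<2h = subst (p <_) L-length (nth-< L p eq)
      ... | z , eq′ rewrite eq′ = refl

      firstHalf-at : ∀ p {x} → nth L p ≡ just x → firstHalf x ≡ ⌊ p <? h ⌋
      firstHalf-at p {x} eq with x ∈? L
      ... | no x∉L = ⊥-elim (x∉L (nth-∈ L p eq))
      ... | yes x∈L rewrite position-unique L-unique p eq x∈L = refl

      below : ∀ {p} → p < h → ⌊ p <? h ⌋ ≡ true
      below {p} p<h with p <? h
      ... | yes _ = refl
      ... | no p≮h = ⊥-elim (p≮h p<h)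

      not-below : ∀ {p} → h ≤ p → ⌊ p <? h ⌋ ≡ false
      not-below {p} h≤p with p <? h
      ... | yes p<h = ⊥-elim (<-irrefl refl (<-≤-trans p<h h≤p))
      ... | no _ = refl

      located : ∀ {x} → x ∈ L → ∃ λ p → nth L p ≡ just x × p < h + h
      located x∈L = position x∈L , nth-position x∈L , subst (position x∈L <_) L-length (nth-< L _ (nth-position x∈L))

    mate-∈ : ∀ {x} → x ∈ L → mate x ∈ L
    mate-∈ x∈L with located x∈L
    ... | p , eq , _ = nth-∈ L _ (at-mate p eq)

    mate-involutive : ∀ {x} → x ∈ L → mate (mate x) ≡ x
    mate-involutive x∈L with located x∈L
    ... | p , eq , p<2h with at-mate (matePosition p) (at-mate p eq)
    ... | eq′ rewrite matePosition-involutive p p<2h = sym (just-injective (trans (sym eq) eq′))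

    mate-≢ : ∀ {x} → x ∈ L → mate x ≢ x
    mate-≢ x∈L mx≡x with located x∈L
    ... | p , eq , p<2h = matePosition-≢ p p<2h
          (trans (sym (position-unique L-unique (matePosition p) (subst (λ y → nth L _ ≡ just y) mx≡x (at-mate p eq)) x∈L))
                 (position-unique L-unique p eq x∈L))

    firstHalf-mate : ∀ {x} → x ∈ L → firstHalf (mate x) ≡ not (firstHalf x)
    firstHalf-mate x∈L with located x∈L
    ... | p , eq , p<2h rewrite firstHalf-at p eq | firstHalf-at (matePosition p) (at-mate p eq) with matePositions p p<2h
    ... | inj₁ (p<h , q≡) rewrite q≡ = trans (not-below (m≤m+n h p)) (cong not (sym (below p<h)))
    ... | inj₂ (q<h , p≡) rewrite p≡ = trans (below q<h) (cong not (sym (not-below (m≤m+n h _))))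

    module _ (T : A → Bool) (pre mid post : List A) (L≡ : L ≡ pre ++ mid ++ post)
      (pre-F : All (λ x → T x ≡ false) pre) (mid-T : All (λ x → T x ≡ true) mid) (post-F : All (λ x → T x ≡ false) post) where

      open Block T pre mid post pre-F mid-T post-F

      private
        nth′ : ∀ {p x} → nth L p ≡ just x → nth (pre ++ mid ++ post) p ≡ just x
        nth′ {p} {x} = subst (λ xs → nth xs p ≡ just x) L≡

        outside : ∀ {p x} → nth L p ≡ just x → T x ≡ false → p < a ⊎ a + m ≤ p
        outside {p} eq Tx with a ≤? p | p <? a + m
        ... | no a≰p | _ = inj₁ (≰⇒> a≰p)
        ... | yes _ | no p≮ = inj₂ (≮⇒≥ p≮)
        ... | yes a≤p | yes p< with () ← trans (sym Tx) (block⁺ p (nth′ eq) a≤p p<)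

        bound : a + m ≤ h + h
        bound = begin
          a + m                                   ≤⟨ +-monoʳ-≤ a (m≤m+n m (length post)) ⟩
          a + (m + length post)                   ≡⟨ cong (a +_) (length-++ mid) ⟨
          a + length (mid ++ post)                ≡⟨ length-++ pre ⟨
          length (pre ++ mid ++ post)             ≡⟨ cong length L≡ ⟨
          length L                                ≡⟨ L-length ⟩
          h + h                                   ∎
          where open ≤-Reasoning

      sparse-block : m ≤ h → ∀ {x} → x ∈ L → T x ≡ true → T (mate x) ≡ false
      sparse-block m≤h {x} x∈L Tx with located x∈L
      ... | p , eq , p<2h with T (mate x) in Tmx
      ...   | false = refl
      ...   | true with block⁻ p (nth′ eq) Tx | block⁻ (matePosition p) (nth′ (at-mate p eq)) Tmx | matePositions p p<2h
      ...     | a≤p , _ | _ , q< | inj₁ (_ , q≡) = ⊥-elim (pair-apart m≤h a≤p (subst (_< a + m) q≡ q<))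
      ...     | _ , p< | a≤q , _ | inj₂ (_ , p≡) = ⊥-elim (pair-apart m≤h a≤q (subst (_< a + m) p≡ p<))

      dense-block : h ≤ m → ∀ {x} → x ∈ L → T x ≡ false → T (mate x) ≡ true
      dense-block h≤m {x} x∈L Tx with located x∈L
      ... | p , eq , p<2h with T (mate x) in Tmx
      ...   | true = refl
      ...   | false with outside eq Tx | outside (at-mate p eq) Tmx | matePositions p p<2h
      ...     | out-p | out-q | inj₁ (p<h , q≡) = ⊥-elim (pair-covered h≤m bound p<h out-p (subst (λ q → q < a ⊎ a + m ≤ q) q≡ out-q))
      ...     | out-p | out-q | inj₂ (q<h , p≡) = ⊥-elim (pair-covered h≤m bound q<h out-q (subst (λ q → q < a ⊎ a + m ≤ q) p≡ out-p))

Majority : ∀ {n} → (Fin n → ℕ) → Fin n → Set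
Majority m i = ℕΣ.sum m < 2 * m i

majority? : ∀ {n} (m : Fin n → ℕ) i → Dec (Majority m i)
majority? m i = ℕΣ.sum m <? 2 * m i

two-≤-sum : ∀ {n} (m : Fin n → ℕ) {i j} → i ≢ j → m i + m j ≤ ℕΣ.sum m
two-≤-sum m {i} {j} i≢j = begin
  m i + m j ≡⟨ cong₂ _+_ (sum-only i) (sum-only j) ⟨
  ℕΣ.sum (only i) + ℕΣ.sum (only j) ≡⟨ ℕΣ.∑-distrib-+ (only i) (only j) ⟨
  ℕΣ.sum (λ k → only i k + only j k) ≤⟨ sum-mono both ⟩
  ℕΣ.sum m ∎
  where
  open ≤-Reasoning
  only : _ → _ → ℕ
  only i k = if k == i then m k else 0
  not-here : ∀ {k l} → k ≢ l → only l k ≡ 0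
  not-here k≢l rewrite ≢⇒==false k≢l = refl
  sum-only : ∀ l → ℕΣ.sum (only l) ≡ m l
  sum-only l = trans (ℕΣ.sum-δ (only l) l (λ k k≢l → not-here k≢l)) (cong (λ b → if b then m l else 0) (==-refl l))
  both : ∀ k → only i k + only j k ≤ m k
  both k with k ≟ i | k ≟ j
  ... | yes refl | yes refl = ⊥-elim (i≢j refl)
  ... | yes refl | no _ = ≤-reflexive (+-identityʳ (m k))
  ... | no _ | yes refl = ≤-refl
  ... | no _ | no _ = z≤n

majority-unique : ∀ {n} (m : Fin n → ℕ) {i j} → Majority m i → Majority m j → i ≡ j
majority-unique m {i} {j} maj-i maj-j with i ≟ j
... | yes i≡j = i≡j
... | no i≢j = ⊥-elim (<-irrefl refl (begin-strict
  ℕΣ.sum m + ℕΣ.sum m     <⟨ +-mono-< maj-i maj-j ⟩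
  2 * m i + 2 * m j       ≡⟨ *-distribˡ-+ 2 (m i) (m j) ⟨
  2 * (m i + m j)         ≤⟨ *-monoʳ-≤ 2 (two-≤-sum m i≢j) ⟩
  2 * ℕΣ.sum m            ≡⟨ cong (ℕΣ.sum m +_) (+-identityʳ (ℕΣ.sum m)) ⟩
  ℕΣ.sum m + ℕΣ.sum m     ∎))
  where open ≤-Reasoning

majority-positive : ∀ {n} {m : Fin n → ℕ} {i} → Majority m i → 0 < m i
majority-positive {m = m} {i} maj with m i
... | suc _ = s≤s z≤n

-- a itself when there is no such class
otherPositive : ∀ {n} → (Fin n → ℕ) → Fin n → Fin n
otherPositive m a with any? (λ j → ¬? (a ≟ j) ×-dec (0 <? m j))
... | yes (j , _) = j
... | no _ = a

otherPositive-spec : ∀ {n} (m : Fin n → ℕ) a → Odd (ℕΣ.sum m) → ¬ Majority m a →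
  a ≢ otherPositive m a × 0 < m (otherPositive m a)
otherPositive-spec m a odd ¬maj with any? (λ j → ¬? (a ≟ j) ×-dec (0 <? m j))
... | yes (j , spec) = spec
... | no none = ⊥-elim (¬maj (subst (_< 2 * m a) (sym sum≡) (m<m+n (m a) (≤-trans pos′ (m≤m+n (m a) 0)))))
  where
  sum≡ : ℕΣ.sum m ≡ m a
  sum≡ = ℕΣ.sum-δ m a (λ j j≢a → n≤0⇒n≡0 (≮⇒≥ (λ pos → none (j , (λ a≡j → j≢a (sym a≡j)) , pos))))
  pos′ : 0 < m a
  pos′ = subst (0 <_) sum≡ (odd-positive odd)

firstPositive : ∀ {n} → (Fin (suc n) → ℕ) → Fin (suc n)
firstPositive m with any? (λ j → 0 <? m j)
... | yes (j , _) = j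
... | no _ = Fin.zero

firstPositive-spec : ∀ {n} (m : Fin (suc n) → ℕ) → Odd (ℕΣ.sum m) → 0 < m (firstPositive m)
firstPositive-spec {n} m odd with any? (λ j → 0 <? m j)
... | yes (_ , pos) = pos
... | no none with () ← trans (sym odd) (cong (_% 2) (trans (ℕΣ.sum-cong-≗ (λ j → n≤0⇒n≡0 (≮⇒≥ (λ pos → none (j , pos))))) (ℕΣ.sum-replicate-zero (suc n))))

-- The ends (a , b) chosen for the bridge between two vertices of odd degree with
-- multiplicities mp and mq towards the terminals.
record Choice (mp mq : Fin 4 → ℕ) (a b : Fin 4) : Set where
  field
    positiveˡ : 0 < mp a
    positiveʳ : 0 < mq b
    majorityˡ : ∀ i → Majority mp i → i ≡ a
    majorityʳ : ∀ i → Majority mq i → i ≡ b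
    equal     : a ≡ b → Majority mp a × Majority mq b

opaque
  choose : (mp mq : Fin 4 → ℕ) → Fin 4 × Fin 4
  choose mp mq with any? (majority? mp) | any? (majority? mq)
  ... | yes (g , _) | yes (g′ , _) = g , g′
  ... | yes (g , _) | no _ = g , otherPositive mq g
  ... | no _ | yes (g′ , _) = otherPositive mp g′ , g′
  ... | no _ | no _ = firstPositive mp , otherPositive mq (firstPositive mp)

  choose-spec : ∀ mp mq → Odd (ℕΣ.sum mp) → Odd (ℕΣ.sum mq) → Choice mp mq (proj₁ (choose mp mq)) (proj₂ (choose mp mq))
  choose-spec mp mq odd-p odd-q with any? (majority? mp) | any? (majority? mq)
  ... | yes (g , maj-g) | yes (g′ , maj-g′) = record
    { positiveˡ = majority-positive {m = mp} maj-g ; positiveʳ = majority-positive {m = mq} maj-g′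
    ; majorityˡ = λ i maj-i → majority-unique mp maj-i maj-g
    ; majorityʳ = λ i maj-i → majority-unique mq maj-i maj-g′
    ; equal = λ _ → maj-g , maj-g′ }
  ... | yes (g , maj-g) | no none′ = record
    { positiveˡ = majority-positive {m = mp} maj-g ; positiveʳ = proj₂ other
    ; majorityˡ = λ i maj-i → majority-unique mp maj-i maj-g
    ; majorityʳ = λ i maj-i → ⊥-elim (none′ (i , maj-i))
    ; equal = λ g≡ → ⊥-elim (proj₁ other g≡) }
    where
    other : g ≢ otherPositive mq g × 0 < mq (otherPositive mq g)
    other = otherPositive-spec mq g odd-q (λ maj → none′ (g , maj))
  ... | no none | yes (g′ , maj-g′) = record
    { positiveˡ = proj₂ other ; positiveʳ = majority-positive {m = mq} maj-g′
    ; majorityˡ = λ i maj-i → ⊥-elim (none (i , maj-i))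
    ; majorityʳ = λ i maj-i → majority-unique mq maj-i maj-g′
    ; equal = λ ≡g′ → ⊥-elim (proj₁ other (sym ≡g′)) }
    where
    other : g′ ≢ otherPositive mp g′ × 0 < mp (otherPositive mp g′)
    other = otherPositive-spec mp g′ odd-p (λ maj → none (g′ , maj))
  ... | no none | no none′ = record
    { positiveˡ = firstPositive-spec mp odd-p ; positiveʳ = proj₂ other
    ; majorityˡ = λ i maj-i → ⊥-elim (none (i , maj-i))
    ; majorityʳ = λ i maj-i → ⊥-elim (none′ (i , maj-i))
    ; equal = λ a≡b → ⊥-elim (proj₁ other a≡b) }
    where
    other : firstPositive mp ≢ otherPositive mq (firstPositive mp) × 0 < mq (otherPositive mq (firstPositive mp))
    other = otherPositive-spec mq (firstPositive mp) odd-q (λ maj → none′ (firstPositive mp , maj))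

-- Pairs of terminals and T-joins

-- The six two-element subsets of Fin 4; pairs 2m and 2m+1 are complementary.
Pair : Set
Pair = Fin 6

pairEnds : Pair → Fin 4 × Fin 4
pairEnds 0F = 0F , 1F
pairEnds 1F = 2F , 3F
pairEnds 2F = 0F , 2F
pairEnds 3F = 1F , 3F
pairEnds 4F = 0F , 3F
pairEnds 5F = 1F , 2F

pairsAt : Fin 4 → Fin 3 → Pair
pairsAt i = lookup (row i)
  where
  row : Fin 4 → Vec Pair 3
  row 0F = 0F ∷ 2F ∷ 4F ∷ []
  row 1F = 0F ∷ 3F ∷ 5F ∷ []
  row 2F = 1F ∷ 2F ∷ 5F ∷ []
  row 3F = 1F ∷ 3F ∷ 4F ∷ []

pairSum : (Fin 4 → Bool) → Pair → Bool
pairSum x q = x (proj₁ (pairEnds q)) xor x (proj₂ (pairEnds q))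

listSum : (Fin 4 → Bool) → List Pair → Bool
listSum x [] = false
listSum x (q ∷ qs) = pairSum x q xor listSum x qs

totalSum : (Fin 4 → Bool) → Bool
totalSum x = x 0F xor (x 1F xor (x 2F xor x 3F))

-- every terminal is an end of an odd number of the pairs in qs
IsJoin : List Pair → Set
IsJoin qs = ∀ x → listSum x qs ≡ totalSum x

listSum-cong : ∀ {x y} → (∀ j → x j ≡ y j) → ∀ qs → listSum x qs ≡ listSum y qs
listSum-cong x≗y [] = refl
listSum-cong x≗y (q ∷ qs) = cong₂ _xor_ (cong₂ _xor_ (x≗y _) (x≗y _)) (listSum-cong x≗y qs)

isJoin : ∀ qs → (∀ᵇ λ a → ∀ᵇ λ b → ∀ᵇ λ c → ∀ᵇ λ d →
                  listSum (lookup (a ∷ b ∷ c ∷ d ∷ [])) qs ≡ᵇ totalSum (lookup (a ∷ b ∷ c ∷ d ∷ []))) ≡ true →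
         IsJoin qs
isJoin qs holds x = trans (listSum-cong x≗ qs)
  (identity⁴ (λ a b c d → listSum (lookup (a ∷ b ∷ c ∷ d ∷ [])) qs) (λ a b c d → totalSum (lookup (a ∷ b ∷ c ∷ d ∷ []))) holds _ _ _ _)
  where
  x≗ : ∀ j → x j ≡ lookup (x 0F ∷ x 1F ∷ x 2F ∷ x 3F ∷ []) j
  x≗ 0F = refl
  x≗ 1F = refl
  x≗ 2F = refl
  x≗ 3F = refl

target-as-sum : ∀ {N} (v : Fin 4 → Fin N) → Injective _≡_ _≡_ v → ∀ w → target v w ≡ totalSum (λ j → v j == w)
target-as-sum v inj w with v 0F ≟ w | v 1F ≟ w | v 2F ≟ w | v 3F ≟ w
... | no _ | no _ | no _ | no _ = refl
... | yes _ | no _ | no _ | no _ = refl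
... | no _ | yes _ | no _ | no _ = refl
... | no _ | no _ | yes _ | no _ = refl
... | no _ | no _ | no _ | yes _ = refl
... | yes p | yes q | _ | _ with () ← inj (trans p (sym q))
... | yes p | _ | yes q | _ with () ← inj (trans p (sym q))
... | yes p | _ | _ | yes q with () ← inj (trans p (sym q))
... | _ | yes p | yes q | _ with () ← inj (trans p (sym q))
... | _ | yes p | _ | yes q with () ← inj (trans p (sym q))
... | _ | _ | yes p | yes q with () ← inj (trans p (sym q))

matchingPairs : Fin 3 → List Pair
matchingPairs 0F = 0F ∷ 1F ∷ []
matchingPairs 1F = 2F ∷ 3F ∷ []
matchingPairs 2F = 4F ∷ 5F ∷ []

starPairs : Fin 4 → List Pair
starPairs c = pairsAt c 0F ∷ pairsAt c 1F ∷ pairsAt c 2F ∷ []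

matching-isJoin : ∀ m → IsJoin (matchingPairs m)
matching-isJoin 0F = isJoin (matchingPairs 0F) refl
matching-isJoin 1F = isJoin (matchingPairs 1F) refl
matching-isJoin 2F = isJoin (matchingPairs 2F) refl

star-isJoin : ∀ c → IsJoin (starPairs c)
star-isJoin 0F = isJoin (starPairs 0F) refl
star-isJoin 1F = isJoin (starPairs 1F) refl
star-isJoin 2F = isJoin (starPairs 2F) refl
star-isJoin 3F = isJoin (starPairs 3F) refl

starSum : (Pair → ℕ) → Fin 4 → ℕ
starSum x i = ℕΣ.sum (λ s → x (pairsAt i s))

data JoinShape (x : Pair → ℕ) (k : ℕ) : Set where
  matching : ∀ m → All (λ q → 0 < x q) (matchingPairs m) → JoinShape x k
  star     : ∀ c → (∀ s → suc k ≤ x (pairsAt c s)) → JoinShape x k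

positive? : ∀ m → m ≡ 0 ⊎ 0 < m
positive? zero = inj₁ refl
positive? (suc m) = inj₂ (s≤s z≤n)

module _ (x : Pair → ℕ) (k : ℕ) (many : ∀ i → suc k ≤ starSum x i) where
  private
    isolated : ∀ i → x (pairsAt i 0F) ≡ 0 → x (pairsAt i 1F) ≡ 0 → x (pairsAt i 2F) ≡ 0 → ⊥
    isolated i z z′ z″ with many i
    ... | h rewrite z | z′ | z″ with () ← h
    only₀ : ∀ i → x (pairsAt i 1F) ≡ 0 → x (pairsAt i 2F) ≡ 0 → suc k ≤ x (pairsAt i 0F)
    only₀ i z′ z″ with many i
    ... | h rewrite z′ | z″ = subst (suc k ≤_) (+-identityʳ _) h
    only₁ : ∀ i → x (pairsAt i 0F) ≡ 0 → x (pairsAt i 2F) ≡ 0 → suc k ≤ x (pairsAt i 1F)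
    only₁ i z z″ with many i
    ... | h rewrite z | z″ = subst (suc k ≤_) (+-identityʳ _) h
    only₂ : ∀ i → x (pairsAt i 0F) ≡ 0 → x (pairsAt i 1F) ≡ 0 → suc k ≤ x (pairsAt i 2F)
    only₂ i z z′ with many i
    ... | h rewrite z | z′ = subst (suc k ≤_) (+-identityʳ _) h

  -- If every terminal lies on more than k pairs, either two complementary pairs are present,
  -- or the absent pairs form a triangle and the star at the fourth terminal has multiplicity > k.
  joinShape : JoinShape x k
  joinShape with positive? (x 0F) | positive? (x 1F) | positive? (x 2F) | positive? (x 3F) | positive? (x 4F) | positive? (x 5F)
  ... | inj₂ p₀ | inj₂ p₁ | _ | _ | _ | _ = matching 0F (p₀ ∷ p₁ ∷ [])
  ... | _ | _ | inj₂ p₂ | inj₂ p₃ | _ | _ = matching 1F (p₂ ∷ p₃ ∷ [])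
  ... | _ | _ | _ | _ | inj₂ p₄ | inj₂ p₅ = matching 2F (p₄ ∷ p₅ ∷ [])
  ... | inj₁ z₀ | _ | inj₁ z₂ | _ | inj₁ z₄ | _ = ⊥-elim (isolated 0F z₀ z₂ z₄)
  ... | inj₁ z₀ | _ | _ | inj₁ z₃ | _ | inj₁ z₅ = ⊥-elim (isolated 1F z₀ z₃ z₅)
  ... | _ | inj₁ z₁ | inj₁ z₂ | _ | _ | inj₁ z₅ = ⊥-elim (isolated 2F z₁ z₂ z₅)
  ... | _ | inj₁ z₁ | _ | inj₁ z₃ | inj₁ z₄ | _ = ⊥-elim (isolated 3F z₁ z₃ z₄)
  ... | inj₁ z₀ | _ | inj₁ z₂ | _ | _ | inj₁ z₅ =
    star 3F λ { 0F → only₀ 2F z₂ z₅ ; 1F → only₁ 1F z₀ z₅ ; 2F → only₂ 0F z₀ z₂ }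
  ... | inj₁ z₀ | _ | _ | inj₁ z₃ | inj₁ z₄ | _ =
    star 2F λ { 0F → only₀ 3F z₃ z₄ ; 1F → only₁ 0F z₀ z₄ ; 2F → only₂ 1F z₀ z₃ }
  ... | _ | inj₁ z₁ | inj₁ z₂ | _ | inj₁ z₄ | _ =
    star 1F λ { 0F → only₀ 0F z₂ z₄ ; 1F → only₁ 3F z₁ z₄ ; 2F → only₂ 2F z₁ z₂ }
  ... | _ | inj₁ z₁ | _ | inj₁ z₃ | _ | inj₁ z₅ =
    star 0F λ { 0F → only₀ 1F z₃ z₅ ; 1F → only₁ 2F z₁ z₅ ; 2F → only₂ 3F z₁ z₃ }

hasType : Maybe Pair → Pair → Bool
hasType nothing q = false
hasType (just q′) q = q′ == q

occurrences : Pair → List Pair → ℕ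
occurrences q [] = 0
occurrences q (q′ ∷ qs) = bit (q′ == q) + occurrences q qs

meets : List Pair → Fin 4 → ℕ
meets qs i = ℕΣ.sum (λ s → occurrences (pairsAt i s) qs)

matching-meets : ∀ m i → meets (matchingPairs m) i ≡ 1
matching-meets = toWitness {a? = all? λ m → all? λ i → meets (matchingPairs m) i ℕ.≟ 1} _

star-meets : ∀ c i → c ≢ i → meets (starPairs c) i ≡ 1
star-meets c i c≢i with toWitness {a? = all? λ c → all? λ i → (c ≟ i) ⊎-dec (meets (starPairs c) i ℕ.≟ 1)} _ c i
... | inj₁ c≡i = ⊥-elim (c≢i c≡i)
... | inj₂ once = once

star-center : ∀ c → occurrences (pairsAt c 0F) (starPairs c) ≡ 1
star-center = toWitness {a? = all? λ c → occurrences (pairsAt c 0F) (starPairs c) ℕ.≟ 1} _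

-- the unordered pair {a, b}; nothing when a ≡ b
opaque
  pairOf : Fin 4 → Fin 4 → Maybe Pair
  pairOf a b with any? (λ q → ≡-dec _≟_ _≟_ (pairEnds q) (a , b) ⊎-dec ≡-dec _≟_ _≟_ (pairEnds q) (b , a))
  ... | yes (q , _) = just q
  ... | no _ = nothing

opaque
  unfolding pairOf

  pairOf-ends : ∀ {a b q} → pairOf a b ≡ just q → pairEnds q ≡ (a , b) ⊎ pairEnds q ≡ (b , a)
  pairOf-ends {a} {b} eq with any? (λ q → ≡-dec _≟_ _≟_ (pairEnds q) (a , b) ⊎-dec ≡-dec _≟_ _≟_ (pairEnds q) (b , a))
  pairOf-ends refl | yes (_ , ends) = ends

  pairOf-defined : ∀ {a b} → a ≢ b → ∃ λ q → pairOf a b ≡ just q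
  pairOf-defined {a} {b} a≢b with any? (λ q → ≡-dec _≟_ _≟_ (pairEnds q) (a , b) ⊎-dec ≡-dec _≟_ _≟_ (pairEnds q) (b , a))
  ... | yes (q , _) = q , refl
  ... | no none with every-pair a b
    where
    every-pair : ∀ a b → a ≡ b ⊎ ∃ λ q → pairEnds q ≡ (a , b) ⊎ pairEnds q ≡ (b , a)
    every-pair = toWitness {a? = all? λ a → all? λ b → (a ≟ b) ⊎-dec any? (λ q → ≡-dec _≟_ _≟_ (pairEnds q) (a , b) ⊎-dec ≡-dec _≟_ _≟_ (pairEnds q) (b , a))} _
  ...   | inj₁ a≡b = ⊥-elim (a≢b a≡b)
  ...   | inj₂ found = ⊥-elim (none found)

pairSum-pairOf : ∀ {a b q} → pairOf a b ≡ just q → ∀ x → pairSum x q ≡ x a xor x b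
pairSum-pairOf {a} {b} {q} eq x with pairEnds q | pairOf-ends eq
... | _ | inj₁ refl = refl
... | _ | inj₂ refl = xor-comm (x b) (x a)

endsAt : Fin 4 → Maybe Pair → Bool
endsAt i t = hasType t (pairsAt i 0F) ∨ (hasType t (pairsAt i 1F) ∨ hasType t (pairsAt i 2F))

pairOf-endsAt : ∀ {a b} i → ((a == i) xor (b == i)) ≡ true → endsAt i (pairOf a b) ≡ true
pairOf-endsAt {a} {b} i one-end = from-pair (pairOf-defined a≢b)
  where
  a≢b : a ≢ b
  a≢b refl with () ← trans (sym (xor-same (a == i))) one-end
  by-evaluation : ∀ q i → pairSum (_== i) q ≡ true → endsAt i (just q) ≡ true
  by-evaluation = toWitness {a? = all? λ q → all? λ i → (pairSum (_== i) q Bool.≟ true) →-dec (endsAt i (just q) Bool.≟ true)} _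
  from-pair : (∃ λ q → pairOf a b ≡ just q) → endsAt i (pairOf a b) ≡ true
  from-pair (q , eq) = subst (λ t → endsAt i t ≡ true) (sym eq) (by-evaluation q i (trans (pairSum-pairOf eq (_== i)) one-end))

-- Packing trails into T-joins

module Packing {N} (H : Graph N) (v : Fin 4 → Fin N) (v-injective : Injective _≡_ _≡_ v)
  (lab : Fin (nE H) → Fin (nE H)) (typ : Fin (nE H) → Maybe Pair)
  (trail-bd : ∀ c q → lab c ≡ c → typ c ≡ just q →
              ∀ w → bd H (λ e → lab e == c) w ≡ pairSum (λ j → v j == w) q) where

  private
    Edge : Set
    Edge = Fin (nE H)

  isTrail : Pair → Edge → Bool
  isTrail q c = (lab c == c) ∧ hasType (typ c) q

  isTrail-unique : ∀ {q q′ c} → isTrail q c ≡ true → isTrail q′ c ≡ true → q ≡ q′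
  isTrail-unique {q} {q′} {c} tq tq′ with typ c | ∧-true₂ {lab c == c} tq | ∧-true₂ {lab c == c} tq′
  ... | just _ | t≡q | t≡q′ = trans (sym (==⇒≡ t≡q)) (==⇒≡ t≡q′)

  count : (Edge → Bool) → Pair → ℕ
  count av q = size (λ c → av c ∧ isTrail q c)

  trailDegree : (Edge → Bool) → Fin 4 → ℕ
  trailDegree av = starSum (count av)

  without : (Edge → Bool) → Edge → Edge → Bool
  without av c e = av e ∧ not (e == c)

  count-without : ∀ av q c → av c ≡ true → isTrail q c ≡ true →
    ∀ q′ → count av q′ ≡ bit (q == q′) + count (without av c) q′
  count-without av q c avc tqc q′ with q ≟ q′
  ... | yes refl = trans (size-remove _ c (trans (cong (_∧ isTrail q c) avc) tqc)) (cong suc (size-cong reorder))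
    where
    reorder : ∀ e → (av e ∧ isTrail q e) ∧ not (e == c) ≡ without av c e ∧ isTrail q e
    reorder e with av e | isTrail q e | e == c
    ... | true | true | true = refl
    ... | true | true | false = refl
    ... | true | false | b = sym (∧-zeroʳ (not b))
    ... | false | _ | _ = refl
  ... | no q≢q′ = size-cong unchanged
    where
    unchanged : ∀ e → av e ∧ isTrail q′ e ≡ without av c e ∧ isTrail q′ e
    unchanged e with e ≟ c
    ... | no _ = cong (_∧ isTrail q′ e) (sym (∧-identityʳ (av e)))
    ... | yes refl with isTrail q′ e in tq′
    ...   | true = ⊥-elim (q≢q′ (isTrail-unique tqc tq′))
    ...   | false = trans (∧-zeroʳ (av e)) (sym (∧-zeroʳ _))

  trail : Edge → Chain H
  trail c e = lab e == c

  -- one available trail for each pair of ends in qs, joined into a chain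
  record Extraction (av : Edge → Bool) (qs : List Pair) : Set where
    field
      chain               : Chain H
      remaining           : Edge → Bool
      chain-bd            : ∀ w → bd H chain w ≡ listSum (λ j → v j == w) qs
      chain-available     : ∀ e → chain e ≡ true → av (lab e) ≡ true
      chain-spent         : ∀ e → chain e ≡ true → remaining (lab e) ≡ false
      remaining-available : ∀ c → remaining c ≡ true → av c ≡ true
      count-remaining     : ∀ q → count av q ≡ occurrences q qs + count remaining q

  extract : ∀ av qs → AllPairs _≢_ qs → All (λ q → 0 < count av q) qs → Extraction av qs
  extract av [] _ _ = record
    { chain = λ _ → false ; remaining = av ; chain-bd = bd-empty H
    ; chain-available = λ _ () ; chain-spent = λ _ () ; remaining-available = λ _ avc → avc
    ; count-remaining = λ _ → refl }
  extract av (q ∷ qs) (q∉qs ∷ distinct) (present ∷ presents) with size-witness _ present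
  ... | c , avc∧tqc = record
    { chain = λ e → trail c e xor R.chain e
    ; remaining = R.remaining
    ; chain-bd = λ w → trans (bd-xor H (trail c) R.chain w) (cong₂ _xor_ (trail-bd c q (==⇒≡ (∧-true₁ tqc)) typc w) (R.chain-bd w))
    ; chain-available = available
    ; chain-spent = spent
    ; remaining-available = λ c′ rc′ → ∧-true₁ (R.remaining-available c′ rc′)
    ; count-remaining = λ q′ → trans (count-without av q c avc tqc q′) (trans (cong (bit (q == q′) +_) (R.count-remaining q′)) (sym (+-assoc (bit (q == q′)) (occurrences q′ qs) (count R.remaining q′))))
    }
    where
    avc = ∧-true₁ avc∧tqc
    tqc = ∧-true₂ {av c} avc∧tqc
    typc : typ c ≡ just q
    typc with typ c | ∧-true₂ {lab c == c} tqc
    ... | just _ | t≡q = cong just (==⇒≡ t≡q)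
    still-present : ∀ {q′} → q ≢ q′ → 0 < count av q′ → 0 < count (without av c) q′
    still-present {q′} q≢q′ pos = subst (0 <_) (trans (count-without av q c avc tqc q′) (cong (_+ _) (cong bit (≢⇒==false q≢q′)))) pos
    module R = Extraction (extract (without av c) qs distinct (All.zipWith (λ (q≢q′ , pos) → still-present q≢q′ pos) (q∉qs , presents)))
    available : ∀ e → (trail c e xor R.chain e) ≡ true → av (lab e) ≡ true
    available e in-chain with trail c e in tce
    ... | true = subst (λ x → av x ≡ true) (sym (==⇒≡ tce)) avc
    ... | false = ∧-true₁ (R.chain-available e in-chain)
    spent : ∀ e → (trail c e xor R.chain e) ≡ true → R.remaining (lab e) ≡ false
    spent e in-chain with trail c e in tce
    ... | false = R.chain-spent e in-chain
    ... | true with R.remaining (lab e) in rl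
    ...   | false = refl
    ...   | true with () ← trans (sym (∧-true₂ {av (lab e)} (R.remaining-available (lab e) rl))) (trans (cong (λ x → not (x == c)) (==⇒≡ tce)) (cong not (==-refl c)))

  trailDegree-extract : ∀ {av qs} (r : Extraction av qs) i →
    trailDegree av i ≡ meets qs i + trailDegree (Extraction.remaining r) i
  trailDegree-extract {av} {qs} r i =
    trans (ℕΣ.sum-cong-≗ (λ s → Extraction.count-remaining r (pairsAt i s)))
          (ℕΣ.∑-distrib-+ (λ s → occurrences (pairsAt i s) qs) (λ s → count (Extraction.remaining r) (pairsAt i s)))

  Packed : ℕ → (Edge → Bool) → Set
  Packed k av = Σ (Fin k → Chain H) λ ps →
    (∀ s t → s ≢ t → ∀ e → ps s e ≡ true → ps t e ≡ false) ×
    (∀ t w → bd H (ps t) w ≡ target v w) ×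
    (∀ t e → ps t e ≡ true → av (lab e) ≡ true)

  prepend : ∀ {k av qs} (r : Extraction av qs) → IsJoin qs → Packed k (Extraction.remaining r) → Packed (suc k) av
  prepend {k} {av} r join (ps , disjoint , ps-bd , ps-available) = ps′ , disjoint′ , bd′ , available′
    where
    open Extraction r
    ps′ : Fin (suc k) → Chain H
    ps′ zero = chain
    ps′ (suc t) = ps t
    first-alone : ∀ t e → chain e ≡ true → ps t e ≡ false
    first-alone t e in-chain with ps t e in pte
    ... | false = refl
    ... | true with () ← trans (sym (ps-available t e pte)) (chain-spent e in-chain)
    disjoint′ : ∀ s t → s ≢ t → ∀ e → ps′ s e ≡ true → ps′ t e ≡ false
    disjoint′ zero zero s≢t = ⊥-elim (s≢t refl)
    disjoint′ zero (suc t) _ e = first-alone t e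
    disjoint′ (suc s) zero _ e in-s with chain e in ce
    ... | false = refl
    ... | true with () ← trans (sym in-s) (first-alone s e ce)
    disjoint′ (suc s) (suc t) s≢t = disjoint s t (λ s≡t → s≢t (cong suc s≡t))
    bd′ : ∀ t w → bd H (ps′ t) w ≡ target v w
    bd′ zero w = trans (chain-bd w) (trans (join (λ j → v j == w)) (sym (target-as-sum v v-injective w)))
    bd′ (suc t) = ps-bd t
    available′ : ∀ t e → ps′ t e ≡ true → av (lab e) ≡ true
    available′ zero = chain-available
    available′ (suc t) e in-t = remaining-available (lab e) (ps-available t e in-t)

  pack : ∀ k av → (∀ i → k ≤ trailDegree av i) → Packed k av
  pack zero av _ = (λ ()) , (λ ()) , (λ ()) , (λ ())
  pack (suc k) av many with joinShape (count av) k many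
  ... | matching m present = prepend r (matching-isJoin m) (pack k (Extraction.remaining r) λ i → lower i (matching-meets m i))
    where
    distinct : ∀ m → AllPairs _≢_ (matchingPairs m)
    distinct 0F = ((λ ()) ∷ []) ∷ [] ∷ []
    distinct 1F = ((λ ()) ∷ []) ∷ [] ∷ []
    distinct 2F = ((λ ()) ∷ []) ∷ [] ∷ []
    r = extract av (matchingPairs m) (distinct m) present
    lower : ∀ i → meets (matchingPairs m) i ≡ 1 → k ≤ trailDegree (Extraction.remaining r) i
    lower i once = s≤s⁻¹ (subst (suc k ≤_) (trans (trailDegree-extract r i) (cong (_+ trailDegree (Extraction.remaining r) i) once)) (many i))
  ... | star c rich = prepend r (star-isJoin c) (pack k (Extraction.remaining r) lower)
    where
    present : All (λ q → 0 < count av q) (starPairs c)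
    present = ≤-trans (s≤s z≤n) (rich 0F) ∷ ≤-trans (s≤s z≤n) (rich 1F) ∷ ≤-trans (s≤s z≤n) (rich 2F) ∷ []
    distinct : ∀ c → AllPairs _≢_ (starPairs c)
    distinct 0F = ((λ ()) ∷ (λ ()) ∷ []) ∷ ((λ ()) ∷ []) ∷ [] ∷ []
    distinct 1F = ((λ ()) ∷ (λ ()) ∷ []) ∷ ((λ ()) ∷ []) ∷ [] ∷ []
    distinct 2F = ((λ ()) ∷ (λ ()) ∷ []) ∷ ((λ ()) ∷ []) ∷ [] ∷ []
    distinct 3F = ((λ ()) ∷ (λ ()) ∷ []) ∷ ((λ ()) ∷ []) ∷ [] ∷ []
    r = extract av (starPairs c) (distinct c) present
    lower : ∀ i → k ≤ trailDegree (Extraction.remaining r) i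
    lower i with c ≟ i
    ... | no c≢i = s≤s⁻¹ (subst (suc k ≤_) (trans (trailDegree-extract r i) (cong (_+ trailDegree (Extraction.remaining r) i) (star-meets c i c≢i))) (many i))
    ... | yes refl = ≤-trans (s≤s⁻¹ (subst (suc k ≤_) (trans (Extraction.count-remaining r (pairsAt c 0F)) (cong (_+ count (Extraction.remaining r) (pairsAt c 0F)) (star-center c))) (rich 0F))) (m≤m+n _ _)

-- A partition of the edges into trails, each listing its edges and its pair of ends;
-- a trail is labelled by its first edge.
module Decomposition {N} (H : Graph N) (trailOf : Fin (nE H) → List (Fin (nE H)) × Maybe Pair)
  (self : ∀ e → e ∈ proj₁ (trailOf e))
  (closed : ∀ {e e′} → e′ ∈ proj₁ (trailOf e) → trailOf e′ ≡ trailOf e) where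

  open import Data.List.Membership.DecPropositional (_≟_ {nE H}) using (_∈?_)

  typ : Fin (nE H) → Maybe Pair
  typ e = proj₂ (trailOf e)

  opaque
    lab : Fin (nE H) → Fin (nE H)
    lab e = fromMaybe e (head (proj₁ (trailOf e)))

    private
      first : ∀ {xs : List (Fin (nE H))} {x} d d′ → x ∈ xs → fromMaybe d (head xs) ≡ fromMaybe d′ (head xs)
      first {_ ∷ _} _ _ _ = refl

      first-∈ : ∀ {xs : List (Fin (nE H))} {x} d → x ∈ xs → fromMaybe d (head xs) ∈ xs
      first-∈ {_ ∷ _} _ _ = here refl

    lab-∈ : ∀ e → lab e ∈ proj₁ (trailOf e)
    lab-∈ e = first-∈ e (self e)

    trailOf-lab : ∀ e → trailOf (lab e) ≡ trailOf e
    trailOf-lab e = closed (lab-∈ e)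

    lab-same : ∀ {e e′} → trailOf e ≡ trailOf e′ → lab e ≡ lab e′
    lab-same {e} {e′} same = trans (first e e′ (self e)) (cong (λ T → fromMaybe e′ (head (proj₁ T))) same)

    lab-lab : ∀ e → lab (lab e) ≡ lab e
    lab-lab e = lab-same (trailOf-lab e)

    typ-lab : ∀ e → typ (lab e) ≡ typ e
    typ-lab e = cong proj₂ (trailOf-lab e)

    lab-injective-on-trail : ∀ {e e′} → lab e ≡ lab e′ → e′ ∈ proj₁ (trailOf e)
    lab-injective-on-trail {e} {e′} same = subst (λ T → e′ ∈ proj₁ T) (trans (sym (trailOf-lab e′)) (trans (cong trailOf (sym same)) (trailOf-lab e))) (self e′)

    lab-is-chain : ∀ {c} → lab c ≡ c → ∀ e → (lab e == c) ≡ chainOf H (proj₁ (trailOf c)) e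
    lab-is-chain {c} rep e with lab e ≟ c | e ∈? proj₁ (trailOf c)
    ... | yes refl | yes _ = refl
    ... | yes refl | no e∉ = ⊥-elim (e∉ (subst (λ T → e ∈ proj₁ T) (sym (trailOf-lab e)) (self e)))
    ... | no lab≢ | yes e∈ = ⊥-elim (lab≢ (trans (lab-same (closed e∈)) rep))
    ... | no _ | no _ = refl

-- The trails of GN

-- For the two edges of a trail through a vertex on side S, a and b record whether their
-- other ends are the isolated terminal.
pair-crossing : ∀ S a b → (S ≡ true → (a ∨ b) ≡ true) → (S ≡ false → (a ∧ b) ≡ false) →
  ((S xor a) ≡ true → (S xor b) ≡ true → ⊥) × ((S xor a) ≡ true → (a xor b) ≡ true) × ((S xor b) ≡ true → (a xor b) ≡ true)
pair-crossing true true true _ _ = (λ ()) , (λ ()) , (λ ())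
pair-crossing true true false _ _ = (λ ()) , (λ ()) , (λ _ → refl)
pair-crossing true false true _ _ = (λ _ ()) , (λ _ → refl) , (λ ())
pair-crossing true false false dense _ with () ← dense refl
pair-crossing false true true _ sparse with () ← sparse refl
pair-crossing false true false _ _ = (λ _ ()) , (λ _ → refl) , (λ ())
pair-crossing false false true _ _ = (λ ()) , (λ ()) , (λ _ → refl)
pair-crossing false false false _ _ = (λ ()) , (λ ()) , (λ ())

-- Likewise for the first and last edges of the trail through a bridge with ends on sides Sp and Sq.
bridge-crossing : ∀ Sp Sq a b → (Sp ≡ true → a ≡ true) → (Sq ≡ true → b ≡ true) → (a ≡ true → b ≡ true → Sp ≡ true × Sq ≡ true) →
  ((Sp xor a) ≡ true → (Sq xor b) ≡ true → ⊥) × ((Sp xor a) ≡ true → (a xor b) ≡ true) × ((Sq xor b) ≡ true → (a xor b) ≡ true)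
bridge-crossing true Sq false b maj-a _ _ with () ← maj-a refl
bridge-crossing Sp true a false _ maj-b _ with () ← maj-b refl
bridge-crossing true true true true _ _ _ = (λ ()) , (λ ()) , (λ ())
bridge-crossing true false true true _ _ both with () ← proj₂ (both refl refl)
bridge-crossing true false true false _ _ _ = (λ ()) , (λ ()) , (λ _ → refl)
bridge-crossing false true true true _ _ both with () ← proj₁ (both refl refl)
bridge-crossing false true false true _ _ _ = (λ _ ()) , (λ _ → refl) , (λ ())
bridge-crossing false false true true _ _ both with () ← proj₁ (both refl refl)
bridge-crossing false false true false _ _ _ = (λ _ ()) , (λ _ → refl) , (λ ())
bridge-crossing false false false true _ _ _ = (λ ()) , (λ ()) , (λ _ → refl)
bridge-crossing false false false false _ _ _ = (λ ()) , (λ ()) , (λ ())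

module TrailSystem {N} (G : Graph N) (v : Fin 4 → Fin N) (v-injective : Injective _≡_ _≡_ v)
  (touches : ∀ e → IsV v (proj₁ (ends G e)) ⊎ IsV v (proj₂ (ends G e)))
  (n : ℕ) (new : Fin n → Fin N × Fin N) (new-ok : ∀ j → NewEdgeOK G v (new j))
  (matched : ∀ y → IsOddY G v y →
    Σ (Fin n) λ j → (incidentB y (new j) ≡ true) × (∀ j′ → incidentB y (new j′) ≡ true → j′ ≡ j)) where

  GN : Graph N
  GN = extend G n new (λ j → proj₁ (new-ok j))

  Edge : Set
  Edge = Fin (nE GN)

  open import Data.List.Membership.DecPropositional (_≟_ {nE GN}) using (_∈?_)

  endsN : Edge → Fin N × Fin N
  endsN = ends GN

  old : Fin (nE G) → Edge
  old x = x ↑ˡ n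

  added : Fin n → Edge
  added j = nE G ↑ʳ j

  ends-old : ∀ x → endsN (old x) ≡ ends G x
  ends-old x rewrite splitAt-↑ˡ (nE G) x n = refl

  ends-added : ∀ j → endsN (added j) ≡ new j
  ends-added j rewrite splitAt-↑ʳ (nE G) n j = refl

  Terminal : Fin N → Set
  Terminal = IsV v

  terminal? : ∀ w → Dec (Terminal w)
  terminal? w = any? (λ i → v i ≟ w)

  EdgeTo : Fin N → Fin 4 → Edge → Set
  EdgeTo y t e = endsN e ≡ (y , v t) ⊎ endsN e ≡ (v t , y)

  edgeTo? : ∀ y t e → Dec (EdgeTo y t e)
  edgeTo? y t e = ≡-dec _≟_ _≟_ (endsN e) (y , v t) ⊎-dec ≡-dec _≟_ _≟_ (endsN e) (v t , y)

  towards : Fin N → Fin 4 → List Edge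
  towards y t = filter (edgeTo? y t) (allFin (nE GN))

  multiplicity : Fin N → Fin 4 → ℕ
  multiplicity y t = length (towards y t)

  otherEnd : Fin N → Edge → Fin N
  otherEnd y e = if proj₁ (endsN e) == y then proj₂ (endsN e) else proj₁ (endsN e)

  classAt : Fin N → Edge → Fin 4
  classAt y e with terminal? (otherEnd y e)
  ... | yes (t , _) = t
  ... | no _ = 0F

  IsBridge : Fin n → Set
  IsBridge j = ¬ Terminal (proj₁ (new j)) × ¬ Terminal (proj₂ (new j))

  bridge? : ∀ j → Dec (IsBridge j)
  bridge? j = ¬? (terminal? (proj₁ (new j))) ×-dec ¬? (terminal? (proj₂ (new j)))

  bridgeEnds : Fin n → Fin 4 × Fin 4
  bridgeEnds j = choose (multiplicity (proj₁ (new j))) (multiplicity (proj₂ (new j)))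

  newAt : Fin N → Maybe (Fin n)
  newAt y with any? (λ j → incidentB y (new j) Bool.≟ true)
  ... | yes (j , _) = just j
  ... | no _ = nothing

  reservedBy : Fin N → (j : Fin n) → Dec (IsBridge j) → Maybe (Fin 4)
  reservedBy y j (yes _) = just (if proj₁ (new j) == y then proj₁ (bridgeEnds j) else proj₂ (bridgeEnds j))
  reservedBy y j (no _) = nothing

  reservedClass : Fin N → Maybe (Fin 4)
  reservedClass y = reservedAt (newAt y)
    where
    reservedAt : Maybe (Fin n) → Maybe (Fin 4)
    reservedAt nothing = nothing
    reservedAt (just j) = reservedBy y j (bridge? j)

  isReserved : Fin N → Fin 4 → Bool
  isReserved y t = hasClass (reservedClass y)
    where
    hasClass : Maybe (Fin 4) → Bool
    hasClass nothing = false
    hasClass (just r) = r == t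

  -- all edges at y except the one continuing the bridge at y
  block : Fin N → Fin 4 → List Edge
  block y t = drop (bit (isReserved y t)) (towards y t)

  queue : Fin N → List Edge
  queue y = block y 0F ++ block y 1F ++ block y 2F ++ block y 3F

  module Pairing (y : Fin N) = HalfPairing _≟_ (queue y) ⌊ length (queue y) /2⌋

  -- the edges of a trail, and its pair of ends (nothing for a closed trail)
  Trail : Set
  Trail = List Edge × Maybe Pair

  -- the trail x, z through y, listed with its edge in the first half of the queue first
  orient : Fin N → Bool → Edge → Edge → Trail
  orient y true x z = (x ∷ z ∷ []) , pairOf (classAt y x) (classAt y z)
  orient y false x z = orient y true z x

  pairTrail : Fin N → Edge → Trail
  pairTrail y e = orient y (Pairing.firstHalf y e) e (Pairing.mate y e)

  headTowards : Fin N → Fin 4 → Edge → Edge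
  headTowards y t default = fromMaybe default (head (towards y t))

  bridgeTrail : Fin n → Trail
  bridgeTrail j = (headTowards p a (added j) ∷ added j ∷ headTowards q b (added j) ∷ []) , pairOf a b
    where
    p = proj₁ (new j)
    q = proj₂ (new j)
    a = proj₁ (bridgeEnds j)
    b = proj₂ (bridgeEnds j)

  trailBy : ∀ y e → Dec (e ∈ queue y) → Maybe (Fin n) → Trail
  trailBy y e (yes _) _ = pairTrail y e
  trailBy y e (no _) (just j) = bridgeTrail j
  trailBy y e (no _) nothing = (e ∷ []) , nothing   -- does not occur

  trailAt : Fin N → Edge → Trail
  trailAt y e = trailBy y e (e ∈? queue y) (newAt y)

  terminal-unique : ∀ {i j w} → v i ≡ w → v j ≡ w → i ≡ j
  terminal-unique vi≡w vj≡w = v-injective (trans vi≡w (sym vj≡w))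

  non-terminal : ∀ {y} t → ¬ Terminal y → y ≢ v t
  non-terminal t ¬Ty y≡vt = ¬Ty (t , sym y≡vt)

  ∈-towards⁺ : ∀ {y t e} → EdgeTo y t e → e ∈ towards y t
  ∈-towards⁺ {y} {t} {e} to = ∈-filter⁺ (edgeTo? y t) (∈-allFin e) to

  ∈-towards⁻ : ∀ {y t e} → e ∈ towards y t → EdgeTo y t e
  ∈-towards⁻ {y} {t} e∈ = proj₂ (∈-filter⁻ (edgeTo? y t) {xs = allFin (nE GN)} e∈)

  towards-unique : ∀ y t → Unique (towards y t)
  towards-unique y t = filter⁺ (edgeTo? y t) (allFin⁺ (nE GN))

  edgeTo-incident : ∀ {y t e} → ¬ Terminal y → EdgeTo y t e → ∀ w → incidentB w (endsN e) ≡ (y == w) xor (v t == w)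
  edgeTo-incident {y} {t} ¬Ty (inj₁ ends≡) w rewrite ends≡ = ∨-as-xor (y == w) (v t == w) (==-exclusive (non-terminal t ¬Ty))
  edgeTo-incident {y} {t} ¬Ty (inj₂ ends≡) w rewrite ends≡ =
    trans (∨-as-xor (v t == w) (y == w) (==-exclusive (λ vt≡y → non-terminal t ¬Ty (sym vt≡y)))) (xor-comm (v t == w) (y == w))

  edgeTo-class-unique : ∀ {y t t′ e} → ¬ Terminal y → EdgeTo y t e → EdgeTo y t′ e → t ≡ t′
  edgeTo-class-unique ¬Ty (inj₁ e≡) (inj₁ e≡′) = v-injective (cong proj₂ (trans (sym e≡) e≡′))
  edgeTo-class-unique {t′ = t′} ¬Ty (inj₁ e≡) (inj₂ e≡′) = ⊥-elim (non-terminal t′ ¬Ty (cong proj₁ (trans (sym e≡) e≡′)))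
  edgeTo-class-unique {t = t} ¬Ty (inj₂ e≡) (inj₁ e≡′) = ⊥-elim (non-terminal t ¬Ty (cong proj₁ (trans (sym e≡′) e≡)))
  edgeTo-class-unique ¬Ty (inj₂ e≡) (inj₂ e≡′) = v-injective (cong proj₁ (trans (sym e≡) e≡′))

  edgeTo-vertex-unique : ∀ {y y′ t t′ e} → ¬ Terminal y → ¬ Terminal y′ → EdgeTo y t e → EdgeTo y′ t′ e → y ≡ y′
  edgeTo-vertex-unique _ _ (inj₁ e≡) (inj₁ e≡′) = cong proj₁ (trans (sym e≡) e≡′)
  edgeTo-vertex-unique {t′ = t′} ¬Ty _ (inj₁ e≡) (inj₂ e≡′) = ⊥-elim (non-terminal t′ ¬Ty (cong proj₁ (trans (sym e≡) e≡′)))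
  edgeTo-vertex-unique {t = t} _ ¬Ty′ (inj₂ e≡) (inj₁ e≡′) = ⊥-elim (non-terminal t ¬Ty′ (cong proj₁ (trans (sym e≡′) e≡)))
  edgeTo-vertex-unique _ _ (inj₂ e≡) (inj₂ e≡′) = cong proj₂ (trans (sym e≡) e≡′)

  classAt-edgeTo : ∀ {y t e} → ¬ Terminal y → EdgeTo y t e → classAt y e ≡ t
  classAt-edgeTo {y} {t} {e} ¬Ty to with terminal? (otherEnd y e) | otherEnd-edgeTo to
    where
    otherEnd-edgeTo : EdgeTo y t e → otherEnd y e ≡ v t
    otherEnd-edgeTo (inj₁ e≡) rewrite e≡ | ==-refl y = refl
    otherEnd-edgeTo (inj₂ e≡) rewrite e≡ | ≢⇒==false (λ vt≡y → non-terminal t ¬Ty (sym vt≡y)) = refl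
  ... | yes (s , vs≡) | other≡ = terminal-unique vs≡ (sym other≡)
  ... | no ¬T | other≡ = ⊥-elim (¬T (t , sym other≡))

  opaque
    trailOf : Edge → Trail
    trailOf e with terminal? (proj₁ (endsN e)) | terminal? (proj₂ (endsN e))
    ... | yes (a , _) | yes (b , _) = (e ∷ []) , pairOf a b
    ... | no _ | yes _ = trailAt (proj₁ (endsN e)) e
    ... | yes _ | no _ = trailAt (proj₂ (endsN e)) e
    ... | no _ | no _ with splitAt (nE G) e
    ...   | inj₁ _ = (e ∷ []) , nothing
    ...   | inj₂ j = bridgeTrail j

    trailOf-edgeTo : ∀ {y t e} → ¬ Terminal y → EdgeTo y t e → trailOf e ≡ trailAt y e
    trailOf-edgeTo {y} {t} {e} ¬Ty to with terminal? (proj₁ (endsN e)) | terminal? (proj₂ (endsN e)) | to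
    ... | yes (a , va≡) | yes _ | inj₁ e≡ = ⊥-elim (¬Ty (a , trans va≡ (cong proj₁ e≡)))
    ... | yes _ | yes (b , vb≡) | inj₂ e≡ = ⊥-elim (¬Ty (b , trans vb≡ (cong proj₂ e≡)))
    ... | no _ | yes _ | inj₁ e≡ = cong (λ x → trailAt x e) (cong proj₁ e≡)
    ... | no ¬T₁ | yes _ | inj₂ e≡ = ⊥-elim (¬T₁ (t , sym (cong proj₁ e≡)))
    ... | yes (a , va≡) | no _ | inj₁ e≡ = ⊥-elim (¬Ty (a , trans va≡ (cong proj₁ e≡)))
    ... | yes _ | no _ | inj₂ e≡ = cong (λ x → trailAt x e) (cong proj₂ e≡)
    ... | no _ | no ¬T₂ | inj₁ e≡ = ⊥-elim (¬T₂ (t , sym (cong proj₂ e≡)))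
    ... | no ¬T₁ | no _ | inj₂ e≡ = ⊥-elim (¬T₁ (t , sym (cong proj₁ e≡)))

    trailOf-bridge : ∀ j → IsBridge j → trailOf (added j) ≡ bridgeTrail j
    trailOf-bridge j (¬T₁ , ¬T₂) = bridge-kind (added j) (subst (λ ab → ¬ Terminal (proj₁ ab)) (sym (ends-added j)) ¬T₁)
      (subst (λ ab → ¬ Terminal (proj₂ ab)) (sym (ends-added j)) ¬T₂) (splitAt-↑ʳ (nE G) n j)
      where
      bridge-kind : ∀ e → ¬ Terminal (proj₁ (endsN e)) → ¬ Terminal (proj₂ (endsN e)) → splitAt (nE G) e ≡ inj₂ j → trailOf e ≡ bridgeTrail j
      bridge-kind e ¬T₁ ¬T₂ split≡ with terminal? (proj₁ (endsN e)) | terminal? (proj₂ (endsN e))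
      ... | yes T₁ | _ = ⊥-elim (¬T₁ T₁)
      ... | no _ | yes T₂ = ⊥-elim (¬T₂ T₂)
      ... | no _ | no _ with splitAt (nE G) e | split≡
      ...   | inj₂ _ | refl = refl

    trailOf-direct : ∀ {e a b} → endsN e ≡ (v a , v b) → trailOf e ≡ ((e ∷ []) , pairOf a b)
    trailOf-direct {e} {a} {b} ends≡ with terminal? (proj₁ (endsN e)) | terminal? (proj₂ (endsN e))
    ... | yes (a′ , va′≡) | yes (b′ , vb′≡) =
      cong₂ (λ x y → (e ∷ []) , pairOf x y) (terminal-unique va′≡ (sym (cong proj₁ ends≡))) (terminal-unique vb′≡ (sym (cong proj₂ ends≡)))
    ... | no ¬T₁ | _ = ⊥-elim (¬T₁ (a , sym (cong proj₁ ends≡)))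
    ... | yes _ | no ¬T₂ = ⊥-elim (¬T₂ (b , sym (cong proj₂ ends≡)))

  incident-ends : ∀ {y} (ab : Fin N × Fin N) → incidentB y ab ≡ true → proj₁ ab ≡ y ⊎ proj₂ ab ≡ y
  incident-ends {y} (a , b) inc with a ≟ y | b ≟ y
  ... | yes a≡y | _ = inj₁ a≡y
  ... | no _ | yes b≡y = inj₂ b≡y

  incident-fst : ∀ (ab : Fin N × Fin N) → incidentB (proj₁ ab) ab ≡ true
  incident-fst (a , b) rewrite ==-refl a = refl

  incident-snd : ∀ (ab : Fin N × Fin N) → incidentB (proj₂ ab) ab ≡ true
  incident-snd (a , b) rewrite ==-refl b = ∨-zeroʳ (a == b)

  new-end-odd : ∀ j {y} → incidentB y (new j) ≡ true → ¬ Terminal y → IsOddY G v y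
  new-end-odd j {y} inc ¬Ty with new-ok j | incident-ends (new j) inc
  ... | _ , inj₁ (odd₁ , _) | inj₁ refl = odd₁
  ... | _ , inj₁ (_ , inj₁ T₂) | inj₂ refl = ⊥-elim (¬Ty T₂)
  ... | _ , inj₁ (_ , inj₂ odd₂) | inj₂ refl = odd₂
  ... | _ , inj₂ (_ , inj₁ T₁) | inj₁ refl = ⊥-elim (¬Ty T₁)
  ... | _ , inj₂ (_ , inj₂ odd₁) | inj₁ refl = odd₁
  ... | _ , inj₂ (odd₂ , _) | inj₂ refl = odd₂

  newAt-incident : ∀ {y j} → newAt y ≡ just j → incidentB y (new j) ≡ true
  newAt-incident {y} eq with any? (λ j → incidentB y (new j) Bool.≟ true)
  newAt-incident refl | yes (_ , inc) = inc

  newAt-unique : ∀ {y} j → incidentB y (new j) ≡ true → ¬ Terminal y → newAt y ≡ just j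
  newAt-unique {y} j inc ¬Ty with any? (λ j → incidentB y (new j) Bool.≟ true) | matched y (new-end-odd j inc ¬Ty)
  ... | yes (j′ , inc′) | _ , _ , only = cong just (trans (only j′ inc′) (sym (only j inc)))
  ... | no none | _ = ⊥-elim (none (j , inc))

  newAt-nothing : ∀ {y} → newAt y ≡ nothing → ¬ IsOddY G v y
  newAt-nothing {y} eq odd-y with any? (λ j → incidentB y (new j) Bool.≟ true) | matched y odd-y
  newAt-nothing () odd-y | yes _ | _
  ... | no none | j , inc , _ = none (j , inc)

  edgeTo-incident-vertex : ∀ {y t e} → EdgeTo y t e → incidentB y (endsN e) ≡ true
  edgeTo-incident-vertex {y} (inj₁ e≡) rewrite e≡ = incident-fst (y , _)
  edgeTo-incident-vertex {y} (inj₂ e≡) rewrite e≡ = incident-snd (_ , y)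

  newAt-none : ∀ {y} → newAt y ≡ nothing → ∀ j → incidentB y (new j) ≡ false
  newAt-none {y} eq j with any? (λ j → incidentB y (new j) Bool.≟ true)
  newAt-none () j | yes _
  ... | no none = ¬-not (λ inc → none (j , inc))

  -- 0 or 1
  classCount : Fin N → Edge → ℕ
  classCount y e = ℕΣ.sum (λ t → bit (does (edgeTo? y t e)))

  classCount-edgeTo : ∀ {y t e} → ¬ Terminal y → EdgeTo y t e → classCount y e ≡ 1
  classCount-edgeTo {y} {t} {e} ¬Ty to = trans (ℕΣ.sum-δ _ t other) (cong bit (dec-true (edgeTo? y t e) to))
    where
    other : ∀ s → s ≢ t → bit (does (edgeTo? y s e)) ≡ 0
    other s s≢t = cong bit (dec-false (edgeTo? y s e) (λ to′ → s≢t (edgeTo-class-unique ¬Ty to′ to)))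

  classCount-none : ∀ {y e} → (∀ t → ¬ EdgeTo y t e) → classCount y e ≡ 0
  classCount-none {y} {e} none = trans (ℕΣ.sum-cong-≗ (λ t → cong bit (dec-false (edgeTo? y t e) (none t)))) (ℕΣ.sum-replicate-zero 4)

  classCount-old : ∀ {y} → ¬ Terminal y → ∀ x → classCount y (old x) ≡ bit (incidentB y (ends G x))
  classCount-old {y} ¬Ty x with incidentB y (ends G x) in inc
  ... | false = classCount-none (λ t to → case (trans (sym (edgeTo-incident-vertex to)) (trans (cong (incidentB y) (ends-old x)) inc)))
    where
    case : true ≡ false → ⊥
    case ()
  ... | true with incident-ends (ends G x) inc | touches x
  ...   | inj₁ refl | inj₁ T₁ = ⊥-elim (¬Ty T₁)
  ...   | inj₁ refl | inj₂ (t , vt≡) = classCount-edgeTo ¬Ty (inj₁ (trans (ends-old x) (cong (y ,_) (sym vt≡))))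
  ...   | inj₂ refl | inj₁ (t , vt≡) = classCount-edgeTo ¬Ty (inj₂ (trans (ends-old x) (cong (_, y) (sym vt≡))))
  ...   | inj₂ refl | inj₂ T₂ = ⊥-elim (¬Ty T₂)

  newToTerminal : Fin N → ℕ
  newToTerminal y = newToTerminalOf (newAt y)
    where
    newToTerminalOf : Maybe (Fin n) → ℕ
    newToTerminalOf nothing = 0
    newToTerminalOf (just j) = bit (not (does (bridge? j)))

  classCount-added : ∀ {y} → ¬ Terminal y → ℕΣ.sum (λ j → classCount y (added j)) ≡ newToTerminal y
  classCount-added {y} ¬Ty with newAt y in at-y
  ... | nothing = trans (ℕΣ.sum-cong-≗ (λ j → classCount-none (λ t to → not-incident j to))) (ℕΣ.sum-replicate-zero n)
    where
    not-incident : ∀ j {t} → EdgeTo y t (added j) → ⊥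
    not-incident j to with () ← trans (sym (newAt-none at-y j)) (trans (cong (incidentB y) (sym (ends-added j))) (edgeTo-incident-vertex to))
  ... | just j = trans (ℕΣ.sum-δ _ j elsewhere) at-j
    where
    incident : ∀ {j′ t} → EdgeTo y t (added j′) → incidentB y (new j′) ≡ true
    incident {j′} to = trans (cong (incidentB y) (sym (ends-added j′))) (edgeTo-incident-vertex to)
    elsewhere : ∀ j′ → j′ ≢ j → classCount y (added j′) ≡ 0
    elsewhere j′ j′≢j = classCount-none (λ t to → j′≢j (just-injective (trans (sym (newAt-unique j′ (incident to) ¬Ty)) at-y)))
    at-j : classCount y (added j) ≡ bit (not (does (bridge? j)))
    at-j = by-kind (bridge? j) (incident-ends (new j) (newAt-incident at-y))
      where
      by-kind : (d : Dec (IsBridge j)) → proj₁ (new j) ≡ y ⊎ proj₂ (new j) ≡ y → classCount y (added j) ≡ bit (not (does d))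
      by-kind (yes (¬T₁ , ¬T₂)) _ = classCount-none λ t → λ
        { (inj₁ e≡) → ¬T₂ (t , sym (trans (cong proj₂ (sym (ends-added j))) (cong proj₂ e≡)))
        ; (inj₂ e≡) → ¬T₁ (t , sym (trans (cong proj₁ (sym (ends-added j))) (cong proj₁ e≡))) }
      by-kind (no ¬bridge) (inj₁ p≡y) with terminal? (proj₂ (new j))
      ... | yes (t , vt≡) = classCount-edgeTo ¬Ty (inj₁ (trans (ends-added j) (cong₂ _,_ p≡y (sym vt≡))))
      ... | no ¬T₂ = ⊥-elim (¬bridge ((λ T₁ → ¬Ty (subst Terminal p≡y T₁)) , ¬T₂))
      by-kind (no ¬bridge) (inj₂ q≡y) with terminal? (proj₁ (new j))
      ... | yes (t , vt≡) = classCount-edgeTo ¬Ty (inj₂ (trans (ends-added j) (cong₂ _,_ (sym vt≡) q≡y)))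
      ... | no ¬T₁ = ⊥-elim (¬bridge (¬T₁ , λ T₂ → ¬Ty (subst Terminal q≡y T₂)))

  -- Every edge of G at a non-terminal leads to a terminal.
  total-multiplicity : ∀ {y} → ¬ Terminal y → ℕΣ.sum (multiplicity y) ≡ degree G y + newToTerminal y
  total-multiplicity {y} ¬Ty = begin
    ℕΣ.sum (multiplicity y)                                         ≡⟨ ℕΣ.sum-cong-≗ (λ t → trans (size-filter (edgeTo? y t)) (size-sum (λ e → does (edgeTo? y t e)))) ⟩
    ℕΣ.sum (λ t → ℕΣ.sum (λ e → bit (does (edgeTo? y t e))))       ≡⟨ ℕΣ.∑-comm (λ t e → bit (does (edgeTo? y t e))) ⟩
    ℕΣ.sum (classCount y)                                           ≡⟨ sum-split (nE G) (classCount y) ⟩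
    ℕΣ.sum (λ x → classCount y (old x)) + ℕΣ.sum (λ j → classCount y (added j)) ≡⟨ cong₂ _+_ (ℕΣ.sum-cong-≗ (classCount-old ¬Ty)) (classCount-added ¬Ty) ⟩
    ℕΣ.sum (λ x → bit (incidentB y (ends G x))) + newToTerminal y           ≡⟨ cong (_+ newToTerminal y) (size-sum (λ x → incidentB y (ends G x))) ⟨
    degree G y + newToTerminal y                                            ∎
    where open ≡-Reasoning


  unreserved : ∀ {y} → reservedClass y ≡ nothing → ∀ t → isReserved y t ≡ false
  unreserved res t rewrite res = refl

  reserved : ∀ {y r} → reservedClass y ≡ just r → ∀ t → isReserved y t ≡ (r == t)
  reserved res t rewrite res = refl

  ∈-block⁻ : ∀ {y t e} → e ∈ block y t → EdgeTo y t e
  ∈-block⁻ {y} {t} e∈ = ∈-towards⁻ (∈-drop⁻ (bit (isReserved y t)) (towards y t) e∈)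

  ∈-queue⁺ : ∀ {y} t {e} → e ∈ block y t → e ∈ queue y
  ∈-queue⁺ 0F e∈ = ∈-++⁺ˡ e∈
  ∈-queue⁺ {y} 1F e∈ = ∈-++⁺ʳ (block y 0F) (∈-++⁺ˡ e∈)
  ∈-queue⁺ {y} 2F e∈ = ∈-++⁺ʳ (block y 0F) (∈-++⁺ʳ (block y 1F) (∈-++⁺ˡ e∈))
  ∈-queue⁺ {y} 3F e∈ = ∈-++⁺ʳ (block y 0F) (∈-++⁺ʳ (block y 1F) (∈-++⁺ʳ (block y 2F) e∈))

  ∈-queue⁻ : ∀ {y e} → e ∈ queue y → ∃ λ t → e ∈ block y t
  ∈-queue⁻ {y} e∈ with ∈-++⁻ (block y 0F) e∈
  ... | inj₁ e∈₀ = 0F , e∈₀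
  ... | inj₂ e∈′ with ∈-++⁻ (block y 1F) e∈′
  ...   | inj₁ e∈₁ = 1F , e∈₁
  ...   | inj₂ e∈″ with ∈-++⁻ (block y 2F) e∈″
  ...     | inj₁ e∈₂ = 2F , e∈₂
  ...     | inj₂ e∈₃ = 3F , e∈₃

  queue-unique : ∀ {y} → ¬ Terminal y → Unique (queue y)
  queue-unique {y} ¬Ty = ++⁺ (blk 0F) (++⁺ (blk 1F) (++⁺ (blk 2F) (blk 3F) d₂) d₁) d₀
    where
    blk : ∀ t → Unique (block y t)
    blk t = drop⁺ (bit (isReserved y t)) (towards-unique y t)
    same : ∀ {s t e} → e ∈ block y s → e ∈ block y t → s ≡ t
    same e∈s e∈t = edgeTo-class-unique ¬Ty (∈-block⁻ e∈s) (∈-block⁻ e∈t)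
    d₂ : ∀ {e} → ¬ (e ∈ block y 2F × e ∈ block y 3F)
    d₂ (e∈₂ , e∈₃) with () ← same e∈₂ e∈₃
    d₁ : ∀ {e} → ¬ (e ∈ block y 1F × e ∈ block y 2F ++ block y 3F)
    d₁ (e∈₁ , e∈) with ∈-++⁻ (block y 2F) e∈
    ... | inj₁ e∈₂ with () ← same e∈₁ e∈₂
    ... | inj₂ e∈₃ with () ← same e∈₁ e∈₃
    d₀ : ∀ {e} → ¬ (e ∈ block y 0F × e ∈ block y 1F ++ block y 2F ++ block y 3F)
    d₀ (e∈₀ , e∈) with ∈-++⁻ (block y 1F) e∈
    ... | inj₁ e∈₁ with () ← same e∈₀ e∈₁
    ... | inj₂ e∈′ with ∈-++⁻ (block y 2F) e∈′
    ...   | inj₁ e∈₂ with () ← same e∈₀ e∈₂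
    ...   | inj₂ e∈₃ with () ← same e∈₀ e∈₃

  outside-queue : ∀ {y t e} → EdgeTo y t e → e ∉ queue y → reservedClass y ≡ just t × head (towards y t) ≡ just e
  outside-queue {y} {t} {e} to e∉ = by-class (reservedClass y) refl
    where
    paired : bit (isReserved y t) ≡ 0 → e ∈ queue y
    paired unres = ∈-queue⁺ t (subst (λ k → e ∈ drop k (towards y t)) (sym unres) (∈-towards⁺ to))
    by-class : ∀ rc → reservedClass y ≡ rc → reservedClass y ≡ just t × head (towards y t) ≡ just e
    by-class nothing res = ⊥-elim (e∉ (paired (cong bit (unreserved res t))))
    by-class (just r) res with r ≟ t
    ... | no r≢t = ⊥-elim (e∉ (paired (cong bit (trans (reserved res t) (≢⇒==false r≢t)))))
    ... | yes refl = res , ∈-not-in-tail (towards y t) (∈-towards⁺ to)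
                             (λ e∈ → e∉ (∈-queue⁺ t (subst (λ k → e ∈ drop k (towards y t)) (sym (cong bit (trans (reserved res t) (==-refl t)))) e∈)))

  head-outside : ∀ {y r e} → ¬ Terminal y → reservedClass y ≡ just r → head (towards y r) ≡ just e → e ∉ queue y
  head-outside {y} {r} {e} ¬Ty res hd e∈ with ∈-queue⁻ e∈
  ... | t , e∈t with edgeTo-class-unique ¬Ty (∈-block⁻ e∈t) (∈-towards⁻ (head-∈ (towards y r) hd))
  ... | refl = head-∉-tail (towards-unique y r) hd (subst (λ k → e ∈ drop k (towards y r)) (cong bit (trans (reserved res r) (==-refl r))) e∈t)

  trailAt-queue : ∀ {y e} → e ∈ queue y → trailAt y e ≡ pairTrail y e
  trailAt-queue {y} {e} e∈ = by (e ∈? queue y)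
    where
    by : ∀ d → trailBy y e d (newAt y) ≡ pairTrail y e
    by (yes _) = refl
    by (no e∉) = ⊥-elim (e∉ e∈)

  trailAt-outside : ∀ {y e j} → e ∉ queue y → newAt y ≡ just j → trailAt y e ≡ bridgeTrail j
  trailAt-outside {y} {e} {j} e∉ at-y = by (e ∈? queue y) (newAt y) at-y
    where
    by : ∀ d m → m ≡ just j → trailBy y e d m ≡ bridgeTrail j
    by (yes e∈) _ _ = ⊥-elim (e∉ e∈)
    by (no _) (just _) refl = refl

  module Bridge (j : Fin n) (is-bridge : IsBridge j) where

    p q : Fin N
    p = proj₁ (new j)
    q = proj₂ (new j)

    a b : Fin 4
    a = proj₁ (bridgeEnds j)
    b = proj₂ (bridgeEnds j)

    p≢q : p ≢ q
    p≢q = proj₁ (new-ok j)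

    at-p : newAt p ≡ just j
    at-p = newAt-unique j (incident-fst (new j)) (proj₁ is-bridge)

    at-q : newAt q ≡ just j
    at-q = newAt-unique j (incident-snd (new j)) (proj₂ is-bridge)

    odd-total : ∀ {y} → ¬ Terminal y → newAt y ≡ just j → Odd (ℕΣ.sum (multiplicity y))
    odd-total {y} ¬Ty at-y = trans (cong (_% 2) (trans (total-multiplicity ¬Ty) (cong (degree G y +_) none-to-terminal)))
                                   (trans (cong (_% 2) (+-identityʳ (degree G y))) (proj₂ (new-end-odd j (newAt-incident at-y) ¬Ty)))
      where
      none-to-terminal : newToTerminal y ≡ 0
      none-to-terminal rewrite at-y = cong (λ d → bit (not d)) (dec-true (bridge? j) is-bridge)

    choice : Choice (multiplicity p) (multiplicity q) a b
    choice = choose-spec _ _ (odd-total (proj₁ is-bridge) at-p) (odd-total (proj₂ is-bridge) at-q)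

    reservedBy-bridge : ∀ y (d : Dec (IsBridge j)) → reservedBy y j d ≡ just (if p == y then a else b)
    reservedBy-bridge y (yes _) = refl
    reservedBy-bridge y (no ¬bridge) = ⊥-elim (¬bridge is-bridge)

    reserved-p : reservedClass p ≡ just a
    reserved-p rewrite at-p = trans (reservedBy-bridge p (bridge? j)) (cong (λ c → just (if c then a else b)) (==-refl p))

    reserved-q : reservedClass q ≡ just b
    reserved-q rewrite at-q = trans (reservedBy-bridge q (bridge? j)) (cong (λ c → just (if c then a else b)) (≢⇒==false p≢q))

    hp hq : Edge
    hp = headTowards p a (added j)
    hq = headTowards q b (added j)

    private
      first : ∀ {xs : List Edge} d → 0 < length xs → head xs ≡ just (fromMaybe d (head xs))
      first {_ ∷ _} _ _ = refl

    hp-head : head (towards p a) ≡ just hp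
    hp-head = first (added j) (Choice.positiveˡ choice)

    hq-head : head (towards q b) ≡ just hq
    hq-head = first (added j) (Choice.positiveʳ choice)

    hp-to : EdgeTo p a hp
    hp-to = ∈-towards⁻ (head-∈ (towards p a) hp-head)

    hq-to : EdgeTo q b hq
    hq-to = ∈-towards⁻ (head-∈ (towards q b) hq-head)

    hp-outside : hp ∉ queue p
    hp-outside = head-outside (proj₁ is-bridge) reserved-p hp-head

    hq-outside : hq ∉ queue q
    hq-outside = head-outside (proj₂ is-bridge) reserved-q hq-head

    trailOf-members : ∀ {e} → e ∈ proj₁ (bridgeTrail j) → trailOf e ≡ bridgeTrail j
    trailOf-members (here refl) = trans (trailOf-edgeTo (proj₁ is-bridge) hp-to) (trailAt-outside hp-outside at-p)
    trailOf-members (there (here refl)) = trailOf-bridge j is-bridge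
    trailOf-members (there (there (here refl))) = trans (trailOf-edgeTo (proj₂ is-bridge) hq-to) (trailAt-outside hq-outside at-q)

    private
      not-added : ∀ {y t e} → ¬ Terminal (proj₁ (new j)) → ¬ Terminal (proj₂ (new j)) → EdgeTo y t e → e ≢ added j
      not-added ¬T₁ ¬T₂ (inj₁ e≡) refl = ¬T₂ (_ , sym (cong proj₂ (trans (sym (ends-added j)) e≡)))
      not-added ¬T₁ ¬T₂ (inj₂ e≡) refl = ¬T₁ (_ , sym (cong proj₁ (trans (sym (ends-added j)) e≡)))

    members-unique : Unique (proj₁ (bridgeTrail j))
    members-unique = (hp≢added ∷ hp≢hq ∷ []) ∷ ((λ added≡hq → hq≢added (sym added≡hq)) ∷ []) ∷ [] ∷ []
      where
      hp≢added = not-added (proj₁ is-bridge) (proj₂ is-bridge) hp-to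
      hq≢added = not-added (proj₁ is-bridge) (proj₂ is-bridge) hq-to
      hp≢hq : hp ≢ hq
      hp≢hq hp≡hq = p≢q (edgeTo-vertex-unique (proj₁ is-bridge) (proj₂ is-bridge) hp-to (subst (EdgeTo q b) (sym hp≡hq) hq-to))

    members-incidence : ∀ {r} → proj₂ (bridgeTrail j) ≡ just r → ∀ w → incidenceSum GN w (proj₁ (bridgeTrail j)) ≡ pairSum (λ i → v i == w) r
    members-incidence pair≡ w
      rewrite edgeTo-incident (proj₁ is-bridge) hp-to w | edgeTo-incident (proj₂ is-bridge) hq-to w | ends-added j
            | ∨-as-xor (p == w) (q == w) (==-exclusive p≢q) =
      trans (through (p == w) (v a == w) (q == w) (v b == w)) (sym (pairSum-pairOf pair≡ (λ i → v i == w)))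
      where
      through = identity⁴ (λ p a q b → (p xor a) xor ((p xor q) xor ((q xor b) xor false))) (λ p a q b → a xor b) refl

  record Reservation (y : Fin N) (r : Fin 4) : Set where
    field
      bridge    : Fin n
      at-y      : newAt y ≡ just bridge
      is-bridge : IsBridge bridge
      positive  : 0 < multiplicity y r
      majority  : ∀ i → Majority (multiplicity y) i → i ≡ r
      odd-total : Odd (ℕΣ.sum (multiplicity y))

  reservation : ∀ {y r} → ¬ Terminal y → reservedClass y ≡ just r → Reservation y r
  reservation {y} {r} ¬Ty reserved with newAt y in at-y
  ... | just j = by-kind (bridge? j) reserved
    where
    by-kind : (d : Dec (IsBridge j)) → reservedBy y j d ≡ just r → Reservation y r
    by-kind (yes br) reserved′ with incident-ends (new j) (newAt-incident at-y) | just-injective reserved′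
    ... | inj₁ refl | r≡ rewrite ==-refl y = record
      { bridge = j ; at-y = at-y ; is-bridge = br ; positive = subst (λ c → 0 < multiplicity y c) r≡ (Choice.positiveˡ choice)
      ; majority = λ i maj → trans (Choice.majorityˡ choice i maj) r≡ ; odd-total = odd-total ¬Ty at-y }
      where open Bridge j br
    ... | inj₂ refl | r≡ rewrite ≢⇒==false (Bridge.p≢q j br) = record
      { bridge = j ; at-y = at-y ; is-bridge = br ; positive = subst (λ c → 0 < multiplicity y c) r≡ (Choice.positiveʳ choice)
      ; majority = λ i maj → trans (Choice.majorityʳ choice i maj) r≡ ; odd-total = odd-total ¬Ty at-y }
      where open Bridge j br

  half : Fin N → ℕ
  half y = ⌊ length (queue y) /2⌋

  length-queue : ∀ y → length (queue y) ≡ ℕΣ.sum (λ t → multiplicity y t ∸ bit (isReserved y t))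
  length-queue y = begin
    length (queue y)                                   ≡⟨ length-++ (block y 0F) ⟩
    l 0F + length (block y 1F ++ block y 2F ++ block y 3F) ≡⟨ cong (l 0F +_) (length-++ (block y 1F)) ⟩
    l 0F + (l 1F + length (block y 2F ++ block y 3F))  ≡⟨ cong (λ x → l 0F + (l 1F + x)) (trans (length-++ (block y 2F)) (cong (l 2F +_) (sym (+-identityʳ (l 3F))))) ⟩
    ℕΣ.sum l                                           ≡⟨ ℕΣ.sum-cong-≗ (λ t → length-drop (bit (isReserved y t)) (towards y t)) ⟩
    ℕΣ.sum (λ t → multiplicity y t ∸ bit (isReserved y t)) ∎
    where
    open ≡-Reasoning
    l : Fin 4 → ℕ
    l t = length (block y t)

  unreserved-even : ∀ {y} → ¬ Terminal y → reservedClass y ≡ nothing → ∃ λ h → ℕΣ.sum (multiplicity y) ≡ h + h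
  unreserved-even {y} ¬Ty res with newAt y in at-y | parity (degree G y)
  ... | nothing | twice h deg≡ = h , trans (total-multiplicity ¬Ty) (trans (cong (degree G y +_) newToTerminal≡) (trans (+-identityʳ _) deg≡))
    where
    newToTerminal≡ : newToTerminal y ≡ 0
    newToTerminal≡ rewrite at-y = refl
  ... | nothing | twice+1 h deg≡ = ⊥-elim (newAt-nothing at-y (¬Ty , trans (cong (_% 2) deg≡) (odd-% h)))
  ... | just j | par = by-kind (bridge? j) res par
    where
    by-kind : (d : Dec (IsBridge j)) → reservedBy y j d ≡ nothing → Parity (degree G y) → ∃ λ h → ℕΣ.sum (multiplicity y) ≡ h + h
    by-kind (no ¬bridge) _ (twice+1 h deg≡) = suc h , trans (total-multiplicity ¬Ty) (trans (cong₂ _+_ deg≡ newToTerminal≡) (cong suc (trans (+-comm (h + h) 1) (sym (+-suc h h)))))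
      where
      newToTerminal≡ : newToTerminal y ≡ 1
      newToTerminal≡ rewrite at-y = cong (λ d → bit (not d)) (dec-false (bridge? j) ¬bridge)
    by-kind (no _) _ (twice h deg≡) with () ← trans (sym (proj₂ (new-end-odd j (newAt-incident at-y) ¬Ty))) (trans (cong (_% 2) deg≡) (even-% h))

  record Balance (y : Fin N) : Set where
    field
      queue-length   : length (queue y) ≡ half y + half y
      majority-block : ∀ i → Majority (multiplicity y) i → half y ≤ length (block y i)
      minority-block : ∀ i → ¬ Majority (multiplicity y) i → length (block y i) ≤ half y

  balance : ∀ {y} → ¬ Terminal y → Balance y
  balance {y} ¬Ty with reservedClass y in res
  ... | nothing = record
    { queue-length = trans len≡ (sym (cong (λ x → x + x) half≡))
    ; majority-block = λ i maj → subst₂ _≤_ (sym half≡) (sym (block≡ i)) (<⇒≤ (halve-< (subst (_< 2 * multiplicity y i) total≡ maj)))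
    ; minority-block = λ i ¬maj → subst₂ _≤_ (sym (block≡ i)) (sym half≡) (halve-≤ (subst (2 * multiplicity y i ≤_) total≡ (≮⇒≥ ¬maj)))
    }
    where
    h = proj₁ (unreserved-even ¬Ty res)
    total≡ : ℕΣ.sum (multiplicity y) ≡ h + h
    total≡ = proj₂ (unreserved-even ¬Ty res)
    block≡ : ∀ t → length (block y t) ≡ multiplicity y t
    block≡ t = trans (length-drop (bit (isReserved y t)) (towards y t)) (cong (λ b → multiplicity y t ∸ bit b) (unreserved res t))
    len≡ : length (queue y) ≡ h + h
    len≡ = trans (length-queue y) (trans (ℕΣ.sum-cong-≗ (λ t → cong (λ b → multiplicity y t ∸ bit b) (unreserved res t))) total≡)
    half≡ : half y ≡ h
    half≡ = trans (cong ⌊_/2⌋ len≡) (half-double h)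
  ... | just r = record
    { queue-length = trans len≡ (sym (cong (λ x → x + x) half≡))
    ; majority-block = majority-block
    ; minority-block = λ i ¬maj → subst (length (block y i) ≤_) (sym half≡)
        (≤-trans (≤-reflexive (length-drop (bit (isReserved y i)) (towards y i))) (≤-trans (m∸n≤m (multiplicity y i) (bit (isReserved y i))) (halve-≤′ {h} {multiplicity y i} (subst (2 * multiplicity y i ≤_) total≡ (≮⇒≥ ¬maj)))))
    }
    where
    R = reservation ¬Ty res
    h = proj₁ (odd-half {ℕΣ.sum (multiplicity y)} (Reservation.odd-total R))
    total≡ : ℕΣ.sum (multiplicity y) ≡ suc (h + h)
    total≡ = proj₂ (odd-half {ℕΣ.sum (multiplicity y)} (Reservation.odd-total R))
    len≡ : length (queue y) ≡ h + h
    len≡ = suc-injective (trans (cong suc (trans (length-queue y) (ℕΣ.sum-cong-≗ (λ t → cong (λ b → multiplicity y t ∸ bit b) (reserved res t)))))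
                               (trans (sum-minus-one (multiplicity y) r (Reservation.positive R)) total≡))
    half≡ : half y ≡ h
    half≡ = trans (cong ⌊_/2⌋ len≡) (half-double h)
    majority-block : ∀ i → Majority (multiplicity y) i → half y ≤ length (block y i)
    majority-block i maj with Reservation.majority R i maj
    ... | refl rewrite half≡ | length-drop (bit (isReserved y i)) (towards y i) | reserved res i | ==-refl i =
      <⇒≤pred (halve-<′ {h} {multiplicity y i} (subst (_< 2 * multiplicity y i) total≡ maj))

  orient-∈ : ∀ y b x z → x ∈ proj₁ (orient y b x z)
  orient-∈ y true x z = here refl
  orient-∈ y false x z = there (here refl)

  orient-members : ∀ {y b x z e} → e ∈ proj₁ (orient y b x z) → e ≡ x ⊎ e ≡ z
  orient-members {b = true} (here refl) = inj₁ refl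
  orient-members {b = true} (there (here refl)) = inj₂ refl
  orient-members {b = false} (here refl) = inj₂ refl
  orient-members {b = false} (there (here refl)) = inj₁ refl

  orient-swap : ∀ y b x z → orient y (not b) z x ≡ orient y b x z
  orient-swap y true x z = refl
  orient-swap y false x z = refl

  orient-unique : ∀ y b {x z} → x ≢ z → Unique (proj₁ (orient y b x z))
  orient-unique y true x≢z = (x≢z ∷ []) ∷ [] ∷ []
  orient-unique y false x≢z = ((λ z≡x → x≢z (sym z≡x)) ∷ []) ∷ [] ∷ []

  orient-incidence : ∀ {y s t x z} b → ¬ Terminal y → EdgeTo y s x → EdgeTo y t z → ∀ {q} → proj₂ (orient y b x z) ≡ just q →
    ∀ w → incidenceSum GN w (proj₁ (orient y b x z)) ≡ pairSum (λ j → v j == w) q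
  orient-incidence {y} {s} {t} {x} {z} true ¬Ty to-x to-z pair≡ w rewrite edgeTo-incident ¬Ty to-x w | edgeTo-incident ¬Ty to-z w =
    trans (through (y == w) (v s == w) (v t == w) false) (sym (pairSum-pairOf pair≡′ (λ j → v j == w)))
    where
    pair≡′ = trans (cong₂ pairOf (sym (classAt-edgeTo ¬Ty to-x)) (sym (classAt-edgeTo ¬Ty to-z))) pair≡
    through = identity⁴ (λ c a b _ → (c xor a) xor ((c xor b) xor false)) (λ c a b _ → a xor b) refl
  orient-incidence false ¬Ty to-x to-z pair≡ w = orient-incidence true ¬Ty to-z to-x pair≡ w

  module PairingAt {y} (¬Ty : ¬ Terminal y) where
    open Pairing y public
    open Properties (queue-unique ¬Ty) (Balance.queue-length (balance ¬Ty)) public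

    edgeTo-queue : ∀ {e} → e ∈ queue y → EdgeTo y (classAt y e) e
    edgeTo-queue e∈ with ∈-queue⁻ e∈
    ... | t , e∈t = subst (λ s → EdgeTo y s _) (sym (classAt-edgeTo ¬Ty (∈-block⁻ e∈t))) (∈-block⁻ e∈t)

    pairTrail-mate : ∀ {e} → e ∈ queue y → pairTrail y (mate e) ≡ pairTrail y e
    pairTrail-mate {e} e∈ rewrite firstHalf-mate e∈ | mate-involutive e∈ = orient-swap y (firstHalf e) e (mate e)

    pairTrail-members : ∀ {e e′} → e ∈ queue y → e′ ∈ proj₁ (pairTrail y e) → e′ ∈ queue y × pairTrail y e′ ≡ pairTrail y e
    pairTrail-members {e} e∈ e′∈ with orient-members {y} {firstHalf e} e′∈
    ... | inj₁ refl = e∈ , refl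
    ... | inj₂ refl = mate-∈ e∈ , pairTrail-mate e∈

    pairTrail-unique : ∀ {e} → e ∈ queue y → Unique (proj₁ (pairTrail y e))
    pairTrail-unique {e} e∈ = orient-unique y (firstHalf e) (λ e≡ → mate-≢ e∈ (sym e≡))

    pairTrail-incidence : ∀ {e q} → e ∈ queue y → proj₂ (pairTrail y e) ≡ just q →
      ∀ w → incidenceSum GN w (proj₁ (pairTrail y e)) ≡ pairSum (λ j → v j == w) q
    pairTrail-incidence {e} e∈ = orient-incidence (firstHalf e) ¬Ty (edgeTo-queue e∈) (edgeTo-queue (mate-∈ e∈))

  data Kind (e : Edge) : Set where
    direct  : ∀ a b → endsN e ≡ (v a , v b) → trailOf e ≡ ((e ∷ []) , pairOf a b) → Kind e
    paired  : ∀ y → ¬ Terminal y → e ∈ queue y → trailOf e ≡ pairTrail y e → Kind e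
    bridged : ∀ j → IsBridge j → e ∈ proj₁ (bridgeTrail j) → trailOf e ≡ bridgeTrail j → Kind e

  kind-at : ∀ {y t e} → ¬ Terminal y → EdgeTo y t e → Kind e
  kind-at {y} {t} {e} ¬Ty to with e ∈? queue y
  ... | yes e∈ = paired y ¬Ty e∈ (trans (trailOf-edgeTo ¬Ty to) (trailAt-queue e∈))
  ... | no e∉ with outside-queue to e∉
  ...   | res , hd with reservation ¬Ty res
  ...     | record { bridge = j ; at-y = at-y ; is-bridge = br } =
    bridged j br member (trans (trailOf-edgeTo ¬Ty to) (trailAt-outside e∉ at-y))
    where
    open Bridge j br
    member : e ∈ proj₁ (bridgeTrail j)
    member with incident-ends (new j) (newAt-incident at-y)
    ... | inj₁ refl = here (just-injective (trans (sym hd) (subst (λ c → head (towards p c) ≡ just hp) (just-injective (trans (sym reserved-p) res)) hp-head)))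
    ... | inj₂ refl = there (there (here (just-injective (trans (sym hd) (subst (λ c → head (towards q c) ≡ just hq) (just-injective (trans (sym reserved-q) res)) hq-head)))))

  kind : ∀ e → Kind e
  kind e with terminal? (proj₁ (endsN e)) | terminal? (proj₂ (endsN e))
  ... | yes (a , va≡) | yes (b , vb≡) = direct a b ends≡ (trailOf-direct ends≡)
    where
    ends≡ = sym (cong₂ _,_ va≡ vb≡)
  ... | no ¬T₁ | yes (t , vt≡) = kind-at ¬T₁ (inj₁ (cong (_ ,_) (sym vt≡)))
  ... | yes (t , vt≡) | no ¬T₂ = kind-at ¬T₂ (inj₂ (cong (_, _) (sym vt≡)))
  ... | no ¬T₁ | no ¬T₂ with splitAt (nE G) e in split
  ...   | inj₁ x with touches x
  ...     | inj₁ T₁ = ⊥-elim (¬T₁ T₁)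
  ...     | inj₂ T₂ = ⊥-elim (¬T₂ T₂)
  kind e | no ¬T₁ | no ¬T₂ | inj₂ j = bridged j (¬T₁ , ¬T₂) (there (here (sym added≡))) (trans (cong trailOf (sym added≡)) (trailOf-bridge j (¬T₁ , ¬T₂)))
    where
    added≡ : added j ≡ e
    added≡ = splitAt⁻¹-↑ʳ split

  trailOf-self : ∀ e → e ∈ proj₁ (trailOf e)
  trailOf-self e with kind e
  ... | direct _ _ _ tr = subst (λ T → e ∈ proj₁ T) (sym tr) (here refl)
  ... | paired y ¬Ty _ tr = subst (λ T → e ∈ proj₁ T) (sym tr) (orient-∈ y (PairingAt.firstHalf ¬Ty e) e (PairingAt.mate ¬Ty e))
  ... | bridged _ _ e∈ tr = subst (λ T → e ∈ proj₁ T) (sym tr) e∈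

  trailOf-closed : ∀ {e e′} → e′ ∈ proj₁ (trailOf e) → trailOf e′ ≡ trailOf e
  trailOf-closed {e} {e′} e′∈ with kind e
  ... | direct _ _ _ tr with subst (λ T → e′ ∈ proj₁ T) tr e′∈
  ...   | here refl = refl
  trailOf-closed {e} {e′} e′∈ | paired y ¬Ty e∈ tr with PairingAt.pairTrail-members ¬Ty e∈ (subst (λ T → e′ ∈ proj₁ T) tr e′∈)
  ...   | e′∈q , same = trans (trans (trailOf-edgeTo ¬Ty (PairingAt.edgeTo-queue ¬Ty e′∈q)) (trailAt-queue e′∈q)) (trans same (sym tr))
  trailOf-closed {e} {e′} e′∈ | bridged j br _ tr = trans (Bridge.trailOf-members j br (subst (λ T → e′ ∈ proj₁ T) tr e′∈)) (sym tr)

  trailOf-unique : ∀ e → Unique (proj₁ (trailOf e))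
  trailOf-unique e with kind e
  ... | direct _ _ _ tr = subst (λ T → Unique (proj₁ T)) (sym tr) ([] ∷ [])
  ... | paired y ¬Ty e∈ tr = subst (λ T → Unique (proj₁ T)) (sym tr) (PairingAt.pairTrail-unique ¬Ty e∈)
  ... | bridged j br _ tr = subst (λ T → Unique (proj₁ T)) (sym tr) (Bridge.members-unique j br)

  trailOf-incidence : ∀ e {q} → proj₂ (trailOf e) ≡ just q → ∀ w → incidenceSum GN w (proj₁ (trailOf e)) ≡ pairSum (λ j → v j == w) q
  trailOf-incidence e {q} typ≡ w with kind e
  ... | direct a b ends≡ tr rewrite tr =
    trans (cong (λ ab → incidentB w ab xor false) ends≡) (trans (xor-identityʳ _) (trans (∨-as-xor (v a == w) (v b == w) (==-exclusive va≢vb)) (sym (pairSum-pairOf typ≡ (λ j → v j == w)))))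
    where
    va≢vb : v a ≢ v b
    va≢vb va≡vb = noLoop GN e (trans (cong proj₁ ends≡) (trans va≡vb (sym (cong proj₂ ends≡))))
  ... | paired y ¬Ty e∈ tr rewrite tr = PairingAt.pairTrail-incidence ¬Ty e∈ typ≡ w
  ... | bridged j br _ tr rewrite tr = Bridge.members-incidence j br typ≡ w

  -- The side of a vertex in the cut isolating v i: the terminal v i, and every
  -- non-terminal at which i has a strict majority.
  sideBy : Fin 4 → ∀ w → Dec (Terminal w) → Bool
  sideBy i w (yes (j , _)) = j == i
  sideBy i w (no _) = ⌊ majority? (multiplicity w) i ⌋

  side : Fin 4 → Fin N → Bool
  side i w = sideBy i w (terminal? w)

  side-terminal : ∀ i j → side i (v j) ≡ (j == i)
  side-terminal i j = by (terminal? (v j))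
    where
    by : (d : Dec (Terminal (v j))) → sideBy i (v j) d ≡ (j == i)
    by (yes (j′ , vj′≡)) = cong (_== i) (terminal-unique vj′≡ refl)
    by (no ¬T) = ⊥-elim (¬T (j , refl))

  side-inner : ∀ i {y} → ¬ Terminal y → side i y ≡ ⌊ majority? (multiplicity y) i ⌋
  side-inner i {y} ¬Ty = by (terminal? y)
    where
    by : (d : Dec (Terminal y)) → sideBy i y d ≡ ⌊ majority? (multiplicity y) i ⌋
    by (yes Ty) = ⊥-elim (¬Ty Ty)
    by (no _) = refl

  target-terminal? : ∀ w → target v w ≡ does (terminal? w)
  target-terminal? w = cong₂ _∨_ (isYes≗does (v 0F ≟ w)) (cong₂ _∨_ (isYes≗does (v 1F ≟ w)) (cong₂ _∨_ (isYes≗does (v 2F ≟ w)) (cong₂ _∨_ (isYes≗does (v 3F ≟ w)) refl)))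

  side-odd : ∀ i → ⊕Σ.sum (λ w → side i w ∧ target v w) ≡ true
  side-odd i = trans (⊕Σ.sum-cong-≗ weight) (trans (⊕Σ.sum-δ _ (v i) (λ w w≢ → ≢⇒==false (λ vi≡w → w≢ (sym vi≡w)))) (==-refl (v i)))
    where
    v== : ∀ j → (j == i) ≡ (v i == v j)
    v== j with j ≟ i | v i ≟ v j
    ... | yes refl | yes _ = refl
    ... | yes refl | no vi≢vi = ⊥-elim (vi≢vi refl)
    ... | no j≢i | yes vi≡vj = ⊥-elim (j≢i (v-injective (sym vi≡vj)))
    ... | no _ | no _ = refl
    weight : ∀ w → side i w ∧ target v w ≡ (v i == w)
    weight w rewrite target-terminal? w = by (terminal? w)
      where
      by : (d : Dec (Terminal w)) → sideBy i w d ∧ does d ≡ (v i == w)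
      by (yes (j , refl)) = trans (∧-identityʳ (j == i)) (v== j)
      by (no ¬T) = trans (∧-zeroʳ _) (sym (≢⇒==false (λ vi≡w → ¬T (i , vi≡w))))

  isOld : Edge → Bool
  isOld e = fromSplit (splitAt (nE G) e)
    where
    fromSplit : Fin (nE G) ⊎ Fin n → Bool
    fromSplit (inj₁ _) = true
    fromSplit (inj₂ _) = false

  cutEdge : Fin 4 → Edge → Bool
  cutEdge i e = isOld e ∧ (side i (proj₁ (endsN e)) xor side i (proj₂ (endsN e)))

  cutEdge-old : ∀ i x → cutEdge i (old x) ≡ cut G (side i) x
  cutEdge-old i x rewrite splitAt-↑ˡ (nE G) x n = refl

  cutEdge-added : ∀ i j → cutEdge i (added j) ≡ false
  cutEdge-added i j rewrite splitAt-↑ʳ (nE G) n j = refl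

  cutEdge-edgeTo : ∀ i {y t e} → EdgeTo y t e → cutEdge i e ≡ true → (side i y xor (t == i)) ≡ true
  cutEdge-edgeTo i {y} {t} {e} (inj₁ e≡) c = trans (cong (side i y xor_) (sym (side-terminal i t))) (trans (cong (λ ab → side i (proj₁ ab) xor side i (proj₂ ab)) (sym e≡)) (∧-true₂ {isOld e} c))
  cutEdge-edgeTo i {y} {t} {e} (inj₂ e≡) c = trans (cong (side i y xor_) (sym (side-terminal i t))) (trans (xor-comm (side i y) (side i (v t))) (trans (cong (λ ab → side i (proj₁ ab) xor side i (proj₂ ab)) (sym e≡)) (∧-true₂ {isOld e} c)))

  record CutOK (i : Fin 4) (T : Trail) : Set where
    field
      at-most-one : ∀ {e e′} → e ∈ proj₁ T → e′ ∈ proj₁ T → cutEdge i e ≡ true → cutEdge i e′ ≡ true → e ≡ e′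
      crossed     : ∀ {e} → e ∈ proj₁ T → cutEdge i e ≡ true → endsAt i (proj₂ T) ≡ true

  cut-direct : ∀ i {e a b} → endsN e ≡ (v a , v b) → CutOK i ((e ∷ []) , pairOf a b)
  cut-direct i {e} {a} {b} ends≡ = record
    { at-most-one = λ { (here refl) (here refl) _ _ → refl }
    ; crossed = λ { (here refl) c → pairOf-endsAt i (trans (sym (cong₂ _xor_ (side-terminal i a) (side-terminal i b)))
                                      (trans (cong (λ ab → side i (proj₁ ab) xor side i (proj₂ ab)) (sym ends≡)) (∧-true₂ {isOld e} c))) }
    }

  cut-bridge : ∀ i j → IsBridge j → CutOK i (bridgeTrail j)
  cut-bridge i j br = record { at-most-one = at-most-one ; crossed = crossed }
    where
    open Bridge j br
    a? = a == i
    b? = b == i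
    majority-a : side i p ≡ true → a? ≡ true
    majority-a s = trans (cong (_== i) (sym (Choice.majorityˡ choice i (from-⌊⌋ (majority? (multiplicity p) i) (trans (sym (side-inner i (proj₁ br))) s))))) (==-refl i)
    majority-b : side i q ≡ true → b? ≡ true
    majority-b s = trans (cong (_== i) (sym (Choice.majorityʳ choice i (from-⌊⌋ (majority? (multiplicity q) i) (trans (sym (side-inner i (proj₂ br))) s))))) (==-refl i)
    both : a? ≡ true → b? ≡ true → side i p ≡ true × side i q ≡ true
    both a≡ b≡ = trans (side-inner i (proj₁ br)) (to-⌊⌋ (majority? (multiplicity p) i) (subst (Majority (multiplicity p)) (==⇒≡ a≡) (proj₁ majorities))) ,
                  trans (side-inner i (proj₂ br)) (to-⌊⌋ (majority? (multiplicity q) i) (subst (Majority (multiplicity q)) (==⇒≡ b≡) (proj₂ majorities)))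
      where
      majorities = Choice.equal choice (trans (==⇒≡ a≡) (sym (==⇒≡ b≡)))
    cases = bridge-crossing (side i p) (side i q) a? b? majority-a majority-b both
    cut-p : cutEdge i hp ≡ true → (side i p xor a?) ≡ true
    cut-p = cutEdge-edgeTo i hp-to
    cut-q : cutEdge i hq ≡ true → (side i q xor b?) ≡ true
    cut-q = cutEdge-edgeTo i hq-to
    not-added : cutEdge i (added j) ≡ true → ⊥
    not-added c with () ← trans (sym c) (cutEdge-added i j)
    at-most-one : ∀ {e e′} → e ∈ proj₁ (bridgeTrail j) → e′ ∈ proj₁ (bridgeTrail j) → cutEdge i e ≡ true → cutEdge i e′ ≡ true → e ≡ e′
    at-most-one (here refl) (here refl) _ _ = refl
    at-most-one (here refl) (there (here refl)) _ c′ = ⊥-elim (not-added c′)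
    at-most-one (here refl) (there (there (here refl))) c c′ = ⊥-elim (proj₁ cases (cut-p c) (cut-q c′))
    at-most-one (there (here refl)) _ c _ = ⊥-elim (not-added c)
    at-most-one (there (there (here refl))) (here refl) c c′ = ⊥-elim (proj₁ cases (cut-p c′) (cut-q c))
    at-most-one (there (there (here refl))) (there (here refl)) _ c′ = ⊥-elim (not-added c′)
    at-most-one (there (there (here refl))) (there (there (here refl))) _ _ = refl
    crossed : ∀ {e} → e ∈ proj₁ (bridgeTrail j) → cutEdge i e ≡ true → endsAt i (pairOf a b) ≡ true
    crossed (here refl) c = pairOf-endsAt i (proj₁ (proj₂ cases) (cut-p c))
    crossed (there (here refl)) c = ⊥-elim (not-added c)
    crossed (there (there (here refl))) c = pairOf-endsAt i (proj₂ (proj₂ cases) (cut-q c))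

  orient-endsAt : ∀ i y b x z → ((classAt y x == i) xor (classAt y z == i)) ≡ true → endsAt i (proj₂ (orient y b x z)) ≡ true
  orient-endsAt i y true x z one-end = pairOf-endsAt i one-end
  orient-endsAt i y false x z one-end = pairOf-endsAt i (trans (xor-comm (classAt y z == i) (classAt y x == i)) one-end)

  module CutAt {y} (¬Ty : ¬ Terminal y) where
    open PairingAt ¬Ty

    isClass : Fin 4 → Edge → Bool
    isClass i e = classAt y e == i

    private
      in-block : ∀ i t {e} → e ∈ block y t → isClass i e ≡ (t == i)
      in-block i t e∈ = cong (_== i) (classAt-edgeTo ¬Ty (∈-block⁻ e∈))

      other-block : ∀ {i} t → t ≢ i → All (λ e → isClass i e ≡ false) (block y t)
      other-block {i} t t≢i = All.tabulate (λ e∈ → trans (in-block i t e∈) (≢⇒==false t≢i))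

    split : ∀ i → Σ (List Edge) λ pre → Σ (List Edge) λ post → queue y ≡ pre ++ block y i ++ post ×
              All (λ e → isClass i e ≡ false) pre × All (λ e → isClass i e ≡ false) post
    split 0F = [] , _ , refl , [] , All.++⁺ (other-block 1F (λ ())) (All.++⁺ (other-block 2F (λ ())) (other-block 3F (λ ())))
    split 1F = block y 0F , _ , refl , other-block 0F (λ ()) , All.++⁺ (other-block 2F (λ ())) (other-block 3F (λ ()))
    split 2F = block y 0F ++ block y 1F , block y 3F , sym (++-assoc (block y 0F) (block y 1F) _) ,
               All.++⁺ (other-block 0F (λ ())) (other-block 1F (λ ())) , other-block 3F (λ ())
    split 3F = block y 0F ++ block y 1F ++ block y 2F , [] ,
               trans (cong (λ l → block y 0F ++ block y 1F ++ block y 2F ++ l) (sym (++-identityʳ (block y 3F))))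
                     (trans (cong (block y 0F ++_) (sym (++-assoc (block y 1F) (block y 2F) _))) (sym (++-assoc (block y 0F) (block y 1F ++ block y 2F) _))) ,
               All.++⁺ (other-block 0F (λ ())) (All.++⁺ (other-block 1F (λ ())) (other-block 2F (λ ()))) , []

    dense : ∀ i → Majority (multiplicity y) i → ∀ {x} → x ∈ queue y → isClass i x ≡ false → isClass i (mate x) ≡ true
    dense i maj = from-split (split i)
      where
      from-split : _ → ∀ {x} → x ∈ queue y → isClass i x ≡ false → isClass i (mate x) ≡ true
      from-split (pre , post , queue≡ , pre-F , post-F) =
        dense-block (isClass i) pre (block y i) post queue≡ pre-F (All.tabulate (λ e∈ → trans (in-block i i e∈) (==-refl i))) post-F
          (Balance.majority-block (balance ¬Ty) i maj)

    sparse : ∀ i → ¬ Majority (multiplicity y) i → ∀ {x} → x ∈ queue y → isClass i x ≡ true → isClass i (mate x) ≡ false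
    sparse i ¬maj = from-split (split i)
      where
      from-split : _ → ∀ {x} → x ∈ queue y → isClass i x ≡ true → isClass i (mate x) ≡ false
      from-split (pre , post , queue≡ , pre-F , post-F) =
        sparse-block (isClass i) pre (block y i) post queue≡ pre-F (All.tabulate (λ e∈ → trans (in-block i i e∈) (==-refl i))) post-F
          (Balance.minority-block (balance ¬Ty) i ¬maj)

    cut-pair : ∀ i {e} → e ∈ queue y → CutOK i (pairTrail y e)
    cut-pair i {e} e∈ = record { at-most-one = at-most-one ; crossed = crossed }
      where
      S = side i y
      A = isClass i e
      B = isClass i (mate e)
      dense′ : S ≡ true → (A ∨ B) ≡ true
      dense′ s = by A refl
        where
        by : ∀ a → A ≡ a → (A ∨ B) ≡ true
        by true a≡ = cong (_∨ B) a≡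
        by false a≡ = trans (cong (_∨ B) a≡) (dense i (from-⌊⌋ (majority? (multiplicity y) i) (trans (sym (side-inner i ¬Ty)) s)) e∈ a≡)
      sparse′ : S ≡ false → (A ∧ B) ≡ false
      sparse′ s = by A refl
        where
        by : ∀ a → A ≡ a → (A ∧ B) ≡ false
        by false a≡ = cong (_∧ B) a≡
        by true a≡ = trans (cong (_∧ B) a≡) (sparse i (from-⌊⌋-false (majority? (multiplicity y) i) (trans (sym (side-inner i ¬Ty)) s)) e∈ a≡)
      cases = pair-crossing S A B dense′ sparse′
      cut-e : cutEdge i e ≡ true → (S xor A) ≡ true
      cut-e = cutEdge-edgeTo i (edgeTo-queue e∈)
      cut-mate : cutEdge i (mate e) ≡ true → (S xor B) ≡ true
      cut-mate = cutEdge-edgeTo i (edgeTo-queue (mate-∈ e∈))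
      one : ∀ {x x′} → x ≡ e ⊎ x ≡ mate e → x′ ≡ e ⊎ x′ ≡ mate e → cutEdge i x ≡ true → cutEdge i x′ ≡ true → x ≡ x′
      one (inj₁ refl) (inj₁ refl) _ _ = refl
      one (inj₁ refl) (inj₂ refl) c c′ = ⊥-elim (proj₁ cases (cut-e c) (cut-mate c′))
      one (inj₂ refl) (inj₁ refl) c c′ = ⊥-elim (proj₁ cases (cut-e c′) (cut-mate c))
      one (inj₂ refl) (inj₂ refl) _ _ = refl
      at-most-one : ∀ {x x′} → x ∈ proj₁ (pairTrail y e) → x′ ∈ proj₁ (pairTrail y e) → cutEdge i x ≡ true → cutEdge i x′ ≡ true → x ≡ x′
      at-most-one x∈ x′∈ = one (orient-members {y} {firstHalf e} x∈) (orient-members {y} {firstHalf e} x′∈)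
      ends-of : ∀ {x} → x ≡ e ⊎ x ≡ mate e → cutEdge i x ≡ true → endsAt i (proj₂ (pairTrail y e)) ≡ true
      ends-of (inj₁ refl) c = orient-endsAt i y (firstHalf e) e (mate e) (proj₁ (proj₂ cases) (cut-e c))
      ends-of (inj₂ refl) c = orient-endsAt i y (firstHalf e) e (mate e) (proj₂ (proj₂ cases) (cut-mate c))
      crossed : ∀ {x} → x ∈ proj₁ (pairTrail y e) → cutEdge i x ≡ true → endsAt i (proj₂ (pairTrail y e)) ≡ true
      crossed x∈ = ends-of (orient-members {y} {firstHalf e} x∈)

  cutOK : ∀ i e → CutOK i (trailOf e)
  cutOK i e with kind e
  ... | direct a b ends≡ tr = subst (CutOK i) (sym tr) (cut-direct i ends≡)
  ... | paired y ¬Ty e∈ tr = subst (CutOK i) (sym tr) (CutAt.cut-pair ¬Ty i e∈)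
  ... | bridged j br _ tr = subst (CutOK i) (sym tr) (cut-bridge i j br)

  open Decomposition GN trailOf trailOf-self trailOf-closed public

  trail-bd : ∀ c q → lab c ≡ c → typ c ≡ just q → ∀ w → bd GN (λ e → lab e == c) w ≡ pairSum (λ j → v j == w) q
  trail-bd c q rep typ≡ w = trans (bd-cong GN (lab-is-chain rep) w) (trans (bd-chainOf GN (trailOf-unique c) w) (trailOf-incidence c typ≡ w))

  open Packing GN v v-injective lab typ trail-bd public

  endingAt : Fin 4 → Fin (nE GN) → Bool
  endingAt i c = (lab c == c) ∧ endsAt i (typ c)

  cut≤endingAt : ∀ i → size (cut G (side i)) ≤ size (endingAt i)
  cut≤endingAt i = size-injection (cut G (side i)) (endingAt i) (λ x → lab (old x)) crossed injective
    where
    cut-old : ∀ {x} → cut G (side i) x ≡ true → cutEdge i (old x) ≡ true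
    cut-old {x} c = trans (cutEdge-old i x) c
    crossed : ∀ x → cut G (side i) x ≡ true → endingAt i (lab (old x)) ≡ true
    crossed x c = trans (cong₂ (λ l t → (l == lab (old x)) ∧ endsAt i t) (lab-lab (old x)) (typ-lab (old x)))
                        (trans (cong (_∧ endsAt i (typ (old x))) (==-refl (lab (old x))))
                               (CutOK.crossed (cutOK i (old x)) (trailOf-self (old x)) (cut-old c)))
    injective : ∀ x x′ → cut G (side i) x ≡ true → cut G (side i) x′ ≡ true → lab (old x) ≡ lab (old x′) → x ≡ x′
    injective x x′ c c′ same = ↑ˡ-injective n x x′
      (CutOK.at-most-one (cutOK i (old x)) (trailOf-self (old x)) (lab-injective-on-trail same) (cut-old c) (cut-old c′))

  endingAt≤degree : ∀ i → size (endingAt i) ≤ trailDegree (λ _ → true) i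
  endingAt≤degree i = begin
    size (endingAt i)                                      ≡⟨ size-cong (λ c → distrib (lab c == c) _ _ _) ⟩
    size (λ c → trail₀ c ∨ (trail₁ c ∨ trail₂ c))          ≤⟨ size-∨-≤ trail₀ (λ c → trail₁ c ∨ trail₂ c) ⟩
    size trail₀ + size (λ c → trail₁ c ∨ trail₂ c)         ≤⟨ +-monoʳ-≤ (size trail₀) (size-∨-≤ trail₁ trail₂) ⟩
    size trail₀ + (size trail₁ + size trail₂)              ≡⟨ cong (λ m → size trail₀ + (size trail₁ + m)) (+-identityʳ (size trail₂)) ⟨
    trailDegree (λ _ → true) i                             ∎
    where
    open ≤-Reasoning
    trail₀ trail₁ trail₂ : Fin (nE GN) → Bool
    trail₀ = isTrail (pairsAt i 0F)
    trail₁ = isTrail (pairsAt i 1F)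
    trail₂ = isTrail (pairsAt i 2F)
    distrib : ∀ r a b c → r ∧ (a ∨ (b ∨ c)) ≡ (r ∧ a) ∨ ((r ∧ b) ∨ (r ∧ c))
    distrib true a b c = refl
    distrib false a b c = refl

lemma2p6 : (k : ℕ) → 1 ≤ k → (N : ℕ) → (G : Graph N) → (v : Fin 4 → Fin N) →
    Injective _≡_ _≡_ v →
    (∀ e → IsV v (proj₁ (ends G e)) ⊎ IsV v (proj₂ (ends G e))) →
    (∀ (D : Fin (nE G) → Bool) → size D < k →
      Σ (Chain G) λ p → (∀ e → D e ≡ true → p e ≡ false) × (∀ w → bd G p w ≡ target v w)) →
    (n : ℕ) → (new : Fin n → Fin N × Fin N) → (newOK : ∀ i → NewEdgeOK G v (new i)) →
    (∀ y → IsOddY G v y →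
      Σ (Fin n) λ i → (incidentB y (new i) ≡ true) × (∀ j → incidentB y (new j) ≡ true → j ≡ i)) →
    Σ (Fin k → Chain (extend G n new (λ i → proj₁ (newOK i)))) λ ps →
      (∀ i j → i ≢ j → ∀ e → ps i e ≡ true → ps j e ≡ false) ×
      (∀ i w → bd (extend G n new (λ i → proj₁ (newOK i))) (ps i) w ≡ target v w)
lemma2p6 k _ N G v v-injective touches robust n new new-ok matched = ps , disjoint , ps-bd
  where
  open TrailSystem G v v-injective touches n new new-ok matched

  enough-trails : ∀ i → k ≤ trailDegree (λ _ → true) i
  enough-trails i = begin
    k                           ≤⟨ odd-cut-size G k (target v) robust (side i) (side-odd i) ⟩
    size (cut G (side i))       ≤⟨ cut≤endingAt i ⟩
    size (endingAt i)           ≤⟨ endingAt≤degree i ⟩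
    trailDegree (λ _ → true) i  ∎
    where open ≤-Reasoning

  packed = pack k (λ _ → true) enough-trails
  ps = proj₁ packed
  disjoint = proj₁ (proj₂ packed)
  ps-bd = proj₁ (proj₂ (proj₂ packed))
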